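{- For $n \ge 2$, let $K_n$ be the complete graph on $n$ vertices and consider its subtrees having at least one edge. (1) Let $p_n$ be the probability that a subtree of $K_n$ chosen uniformly at random (every subtree equally likely) is a spanning tree of $K_n$. Then $\lim_{n\to\infty} p_n = e^{ -e^{ -1}} = 0.692201\dots$. (2) Let $q_n$ be the probability that a subtree of $K_n$ chosen with weighted probability (the probability of choosing a subtree $T$ is proportional to its number of edges $|E(T)|$) is a spanning tree of $K_n$. Then $\lim_{n\to\infty} q_n = e^{ -e^{ -1}}$.
   Context: A subtree of a graph $G$ is a subgraph that is a tree; here only subtrees with at least one edge are counted. Equivalently, with $a_k=\binom{n}{k+1}(k+1)^{k-1}$ the number of $k$-edge subtrees of $K_n$, $p_n = a_{n-1}/\sum_{k=1}^{n-1}a_k$ and $q_n = (n-1)a_{n-1}/\sum_{k=1}^{n-1}k a_k$. -}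

module Defs where

open import Data.Nat as ℕ using (ℕ; zero; suc; _∸_; _≥_; _!)
open import Data.Nat.Combinatorics using (_C_)
open import Data.Nat.Properties using (_!≢0)
open import Data.Integer using (+_; -[1+_])
open import Data.Rational using (ℚ; _/_; 0ℚ; 1ℚ; _+_; _*_; -_; _-_; ∣_∣; _<_)
open import Data.Product using (∃-syntax)

sumFrom : ℕ → ℕ → (ℕ → ℕ) → ℕ
sumFrom lo zero f = 0
sumFrom lo (suc len) f = f lo ℕ.+ sumFrom (suc lo) len f

-- a_k(n) = C(n, k+1) (k+1)^(k-1): number of k-edge subtrees of K_n
a : ℕ → ℕ → ℕ
a n k = (n C suc k) ℕ.* (suc k ℕ.^ (k ∸ 1))

totA : ℕ → ℕ
totA n = sumFrom 1 (n ∸ 1) (λ k → a n k)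

totKA : ℕ → ℕ
totKA n = sumFrom 1 (n ∸ 1) (λ k → k ℕ.* a n k)

-- x / d as a rational; d = 0 is given the junk value 0 (never used for n ≥ 2)
frac : ℕ → ℕ → ℚ
frac x zero = 0ℚ
frac x (suc d) = (+ x) / suc d

p : ℕ → ℚ
p n = frac (a n (n ∸ 1)) (totA n)

q : ℕ → ℚ
q n = frac ((n ∸ 1) ℕ.* a n (n ∸ 1)) (totKA n)

pow : ℚ → ℕ → ℚ
pow x zero = 1ℚ
pow x (suc k) = x * pow x k

sumℚ : ℕ → (ℕ → ℚ) → ℚ
sumℚ zero f = 0ℚ
sumℚ (suc m) f = sumℚ m f + f m

invFact : ℕ → ℚ
invFact j = _/_ (+ 1) (j !) {{j !≢0}}

xTrunc : ℕ → ℚ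
xTrunc M = sumℚ M (λ j → pow (- 1ℚ) j * invFact j)

-- e^{-e^{-1}} truncated: L_M = Σ_{k<M} (-x_M)^k / k!   (L_M → e^{-e^{-1}})
LTrunc : ℕ → ℚ
LTrunc M = sumℚ M (λ k → pow (- xTrunc M) k * invFact k)

-- a rational sequence s converges to the real number c := lim_M c M
-- (c a convergent rational sequence): ∀ ε > 0, ∃ N, ∀ n ≥ N, |s n - c| < ε,
-- where |s n - c| < ε is witnessed by |s n - c M| < ε for all large M.
-- (Equivalent to the usual definition, since ε is arbitrary.)
ConvergesTo : (ℕ → ℚ) → (ℕ → ℚ) → Set
ConvergesTo s c = ∀ (ε : ℚ) → 0ℚ < ε → ∃[ N ] (∀ n → n ≥ N →
  ∃[ M₀ ] (∀ M → M ≥ M₀ → ∣ s n - c M ∣ < ε))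

-- Normalise by the n^(n-2) spanning trees, with r = 1/n. The subtrees of K_n missing exactly j vertices
-- then contribute (1/j!) (1 - r) ⋯ (1 - (j-1) r) (1 - j r)^(n-j-2) → e^(-j)/j!, uniformly dominated by
-- 3^j/j!, so the normalised count S_n tends to Σ_j (e^(-1))^j/j! = e^(e^(-1)) and p_n = 1/S_n tends to
-- e^(-e^(-1)). For q_n the j-th term carries the extra weight 1 - j/(n-1) → 1, which does not change the
-- limit. The rational approximations are the truncated series: (1 - r)^n is compared with
-- x_M = Σ_(i<M) (-1)^i/i! through the binomial expansion, and 1/e^x with e^(-x) through
-- (1 - y/m)^m (1 + y/m)^m = (1 - y²/m²)^m ≥ 1 - y²/m (Bernoulli).

module Submission where

open import Defs

open import Data.Nat as ℕ using (ℕ; zero; suc; _∸_; _!; s≤s; z≤n)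
import Data.Nat.Properties as ℕP
open import Data.Nat.DivMod using (m/n*n≡m)
open import Data.Nat.Combinatorics
  using (_C_; nCk≡nPk/k!; nCk+nC[k+1]≡[n+1]C[k+1]; k>n⇒nCk≡0; nCk≡nC[n∸k]; nCn≡1)
open import Data.Nat.Combinatorics.Base using (_P′_)
import Data.Nat.Combinatorics.Base as Combinatorics
open import Data.Nat.Combinatorics.Specification using (k!∣nP′k)
import Data.Integer as ℤ
import Data.Integer.Properties as ℤP
open import Data.Integer using () renaming (+_ to pos)
open import Data.Rational
  using (ℚ; mkℚ; 1/_; toℚᵘ; _+_; _*_; _-_; -_; 0ℚ; 1ℚ; ∣_∣; _≤_; _<_; _/_; NonZero; nonNegative; positive; *<*)
open import Data.Rational.Properties
import Data.Rational.Unnormalised as ℚᵘ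
import Data.Rational.Unnormalised.Properties as ℚᵘP
open import Data.Bool using (true)
open import Data.Product using (_×_; ∃-syntax; _,_; proj₁; proj₂)
open import Data.Sum using (inj₁; inj₂)
open import Data.Empty using (⊥-elim)
open import Function using (_∘_)
open import Relation.Binary.PropositionalEquality
open import Relation.Nullary.Decidable using (dec⇒maybe)
open import Tactic.RingSolver using (solve-∀)
open import Tactic.RingSolver.Core.AlmostCommutativeRing using (AlmostCommutativeRing; fromCommutativeRing)

ℚring : AlmostCommutativeRing _ _
ℚring = fromCommutativeRing +-*-commutativeRing (λ x → dec⇒maybe (0ℚ ≟ x))

ι : ℕ → ℚ
ι n = pos n / 1

toℚᵘ-ι : ∀ n → toℚᵘ (ι n) ℚᵘ.≃ ℚᵘ.mkℚᵘ (pos n) 0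
toℚᵘ-ι n = toℚᵘ-fromℚᵘ (ℚᵘ.mkℚᵘ (pos n) 0)

ι-homo-+ : ∀ m n → ι (m ℕ.+ n) ≡ ι m + ι n
ι-homo-+ m n = toℚᵘ-injective (ℚᵘP.≃-trans (toℚᵘ-ι (m ℕ.+ n)) (ℚᵘP.≃-trans sum
  (ℚᵘP.≃-sym (ℚᵘP.≃-trans (toℚᵘ-homo-+ (ι m) (ι n)) (ℚᵘP.+-cong (toℚᵘ-ι m) (toℚᵘ-ι n))))))
  where
  sum : ℚᵘ.mkℚᵘ (pos (m ℕ.+ n)) 0 ℚᵘ.≃ (ℚᵘ.mkℚᵘ (pos m) 0 ℚᵘ.+ ℚᵘ.mkℚᵘ (pos n) 0)
  sum = ℚᵘ.*≡* (cong₂ ℤ._*_ (cong₂ ℤ._+_ (sym (ℤP.*-identityʳ (pos m))) (sym (ℤP.*-identityʳ (pos n)))) refl)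

ι-homo-* : ∀ m n → ι (m ℕ.* n) ≡ ι m * ι n
ι-homo-* m n = toℚᵘ-injective (ℚᵘP.≃-trans (toℚᵘ-ι (m ℕ.* n)) (ℚᵘP.≃-trans product
  (ℚᵘP.≃-sym (ℚᵘP.≃-trans (toℚᵘ-homo-* (ι m) (ι n)) (ℚᵘP.*-cong (toℚᵘ-ι m) (toℚᵘ-ι n))))))
  where
  product : ℚᵘ.mkℚᵘ (pos (m ℕ.* n)) 0 ℚᵘ.≃ (ℚᵘ.mkℚᵘ (pos m) 0 ℚᵘ.* ℚᵘ.mkℚᵘ (pos n) 0)
  product = ℚᵘ.*≡* (trans (ℤP.*-identityʳ _) (trans (ℤP.pos-* m n) (sym (ℤP.*-identityʳ _))))

ι-suc : ∀ n → ι (suc n) ≡ 1ℚ + ι n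
ι-suc n = ι-homo-+ 1 n

ι-homo-∸ : ∀ {m n} → n ℕ.≤ m → ι (m ∸ n) + ι n ≡ ι m
ι-homo-∸ {m} {n} n≤m = trans (sym (ι-homo-+ (m ∸ n) n)) (cong ι (ℕP.m∸n+n≡m n≤m))

ι-nonNeg : ∀ n → 0ℚ ≤ ι n
ι-nonNeg n = nonNegative⁻¹ (ι n) {{normalize-nonNeg n 1}}

ι-mono-≤ : ∀ {m n} → m ℕ.≤ n → ι m ≤ ι n
ι-mono-≤ {m} {n} m≤n = subst₂ _≤_ (+-identityʳ (ι m))
  (trans (sym (ι-homo-+ m (n ∸ m))) (cong ι (ℕP.m+[n∸m]≡n m≤n)))
  (+-monoʳ-≤ (ι m) (ι-nonNeg (n ∸ m)))

0≤1 : 0ℚ ≤ 1ℚ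
0≤1 = ι-nonNeg 1

0<1 : 0ℚ < 1ℚ
0<1 = *<* (ℤ.+<+ (s≤s z≤n))

1≤ι-suc : ∀ n → 1ℚ ≤ ι (suc n)
1≤ι-suc n = ι-mono-≤ {1} {suc n} (s≤s z≤n)

0<ι-suc : ∀ n → 0ℚ < ι (suc n)
0<ι-suc n = <-≤-trans 0<1 (1≤ι-suc n)

frac-*-denominator : ∀ x d → frac x (suc d) * ι (suc d) ≡ ι x
frac-*-denominator x d = toℚᵘ-injective (ℚᵘP.≃-trans (toℚᵘ-homo-* (frac x (suc d)) (ι (suc d)))
  (ℚᵘP.≃-trans (ℚᵘP.*-cong (toℚᵘ-fromℚᵘ (ℚᵘ.mkℚᵘ (pos x) d)) (toℚᵘ-ι (suc d)))
  (ℚᵘP.≃-trans cancel (ℚᵘP.≃-sym (toℚᵘ-ι x)))))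
  where
  cancel : (ℚᵘ.mkℚᵘ (pos x) d ℚᵘ.* ℚᵘ.mkℚᵘ (pos (suc d)) 0) ℚᵘ.≃ ℚᵘ.mkℚᵘ (pos x) 0
  cancel = ℚᵘ.*≡* (trans (ℤP.*-identityʳ _) (cong (λ z → pos x ℤ.* pos z) (sym (ℕP.*-identityʳ (suc d)))))

0≤q-p⇒p≤q : ∀ {p q} → 0ℚ ≤ q - p → p ≤ q
0≤q-p⇒p≤q {p} {q} h = subst₂ _≤_ (+-identityˡ p) (cancel p q) (+-monoˡ-≤ p h)
  where
  cancel : ∀ p q → q - p + p ≡ q
  cancel = solve-∀ ℚring

p≤q⇒0≤q-p : ∀ {p q} → p ≤ q → 0ℚ ≤ q - p
p≤q⇒0≤q-p {p} {q} h = subst (_≤ q - p) (+-inverseʳ p) (+-monoˡ-≤ (- p) h)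

0≤p⇒1-p≤1 : ∀ {p} → 0ℚ ≤ p → 1ℚ - p ≤ 1ℚ
0≤p⇒1-p≤1 {p} h = 0≤q-p⇒p≤q (subst (0ℚ ≤_) (double-complement p) h)
  where
  double-complement : ∀ p → p ≡ 1ℚ - (1ℚ - p)
  double-complement = solve-∀ ℚring

*-monoʳ-≤-0≤ : ∀ {p q r} → 0ℚ ≤ r → p ≤ q → p * r ≤ q * r
*-monoʳ-≤-0≤ {r = r} 0≤r p≤q = *-monoʳ-≤-nonNeg r {{nonNegative 0≤r}} p≤q

*-monoˡ-≤-0≤ : ∀ {p q r} → 0ℚ ≤ r → p ≤ q → r * p ≤ r * q
*-monoˡ-≤-0≤ {p} {q} {r} 0≤r p≤q = subst₂ _≤_ (*-comm p r) (*-comm q r) (*-monoʳ-≤-0≤ 0≤r p≤q)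

*-mono-≤-0≤ : ∀ {p q r s} → 0ℚ ≤ p → 0ℚ ≤ r → p ≤ q → r ≤ s → p * r ≤ q * s
*-mono-≤-0≤ 0≤p 0≤r p≤q r≤s = ≤-trans (*-monoʳ-≤-0≤ 0≤r p≤q) (*-monoˡ-≤-0≤ (≤-trans 0≤p p≤q) r≤s)

0≤* : ∀ {p q} → 0ℚ ≤ p → 0ℚ ≤ q → 0ℚ ≤ p * q
0≤* {p} {q} 0≤p 0≤q = subst (_≤ p * q) (*-zeroʳ p) (*-monoˡ-≤-0≤ 0≤p 0≤q)

0<* : ∀ {p q} → 0ℚ < p → 0ℚ < q → 0ℚ < p * q
0<* {p} {q} 0<p 0<q = positive⁻¹ (p * q) {{pos*pos⇒pos p {{positive 0<p}} q {{positive 0<q}}}}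

∣p∣≤q⇐-q≤p≤q : ∀ {p q} → - q ≤ p → p ≤ q → ∣ p ∣ ≤ q
∣p∣≤q⇐-q≤p≤q {p} {q} -q≤p p≤q with ∣p∣≡p∨∣p∣≡-p p
... | inj₁ ∣p∣≡p  = subst (_≤ q) (sym ∣p∣≡p) p≤q
... | inj₂ ∣p∣≡-p = subst₂ _≤_ (sym ∣p∣≡-p) (neg-involutive q) (neg-antimono-≤ -q≤p)
  where
  neg-involutive : ∀ q → - (- q) ≡ q
  neg-involutive = solve-∀ ℚring

∣p∣≤1⇐0≤p≤1 : ∀ {p} → 0ℚ ≤ p → p ≤ 1ℚ → ∣ p ∣ ≤ 1ℚ
∣p∣≤1⇐0≤p≤1 0≤p p≤1 = subst (_≤ 1ℚ) (sym (0≤p⇒∣p∣≡p 0≤p)) p≤1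

∣p-q∣≡∣q-p∣ : ∀ p q → ∣ p - q ∣ ≡ ∣ q - p ∣
∣p-q∣≡∣q-p∣ p q = trans (cong ∣_∣ (negate p q)) (∣-p∣≡∣p∣ (q - p))
  where
  negate : ∀ p q → p - q ≡ - (q - p)
  negate = solve-∀ ℚring

∣*∣-mono-≤ : ∀ {p q c d} → ∣ p ∣ ≤ c → ∣ q ∣ ≤ d → ∣ p * q ∣ ≤ c * d
∣*∣-mono-≤ {p} {q} ∣p∣≤c ∣q∣≤d =
  subst (_≤ _) (sym (∣p*q∣≡∣p∣*∣q∣ p q)) (*-mono-≤-0≤ (0≤∣p∣ p) (0≤∣p∣ q) ∣p∣≤c ∣q∣≤d)

p*p≡∣p∣*∣p∣ : ∀ p → p * p ≡ ∣ p ∣ * ∣ p ∣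
p*p≡∣p∣*∣p∣ p with ∣p∣≡p∨∣p∣≡-p p
... | inj₁ ∣p∣≡p  = cong₂ _*_ (sym ∣p∣≡p) (sym ∣p∣≡p)
... | inj₂ ∣p∣≡-p = trans (square-neg p) (cong₂ _*_ (sym ∣p∣≡-p) (sym ∣p∣≡-p))
  where
  square-neg : ∀ p → p * p ≡ (- p) * (- p)
  square-neg = solve-∀ ℚring

Eventually : (ℕ → Set) → Set
Eventually P = ∃[ N ] (∀ n → N ℕ.≤ n → P n)

eventually-≥ : ∀ m → Eventually (m ℕ.≤_)
eventually-≥ m = m , λ _ m≤n → m≤n

eventually-map : ∀ {P Q : ℕ → Set} → (∀ n → P n → Q n) → Eventually P → Eventually Q
eventually-map f (N , p) = N , λ n N≤n → f n (p n N≤n)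

eventually-× : ∀ {P Q : ℕ → Set} → Eventually P → Eventually Q → Eventually (λ n → P n × Q n)
eventually-× (M , p) (N , q) =
  M ℕ.⊔ N , λ n h → p n (ℕP.≤-trans (ℕP.m≤m⊔n M N) h) , q n (ℕP.≤-trans (ℕP.m≤n⊔m M N) h)

eventually-+ : ∀ {P : ℕ → Set} d → Eventually P → Eventually (λ k → P (d ℕ.+ k))
eventually-+ d (N , p) = N , λ k N≤k → p (d ℕ.+ k) (ℕP.≤-trans N≤k (ℕP.m≤n+m k d))

eventually-suc-suc⁻ : ∀ {Q : ℕ → Set} → Eventually (λ k → Q (suc (suc k))) → Eventually Q
eventually-suc-suc⁻ {Q} (N , q) = suc (suc N) , at
  where
  at : ∀ n → suc (suc N) ℕ.≤ n → Q n
  at (suc (suc k)) (s≤s (s≤s N≤k)) = q k N≤k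

eventually-witness : ∀ {P : ℕ → Set} → Eventually P → ∃[ n ] P n
eventually-witness (N , p) = N , p N ℕP.≤-refl

eventually-suc : ∀ {P : ℕ → Set} → Eventually P → ∃[ n ] P (suc n)
eventually-suc (N , p) = N , p (suc N) (ℕP.n≤1+n N)

archimedean : ∀ q → ∃[ N ] (q ≤ ι N)
archimedean q@(mkℚ num d _) = ℤ.∣ num ∣ , ≤-trans (p≤∣p∣ q)
  (toℚᵘ-cancel-≤ (ℚᵘP.≤-respʳ-≃ (ℚᵘP.≃-sym (toℚᵘ-ι k)) (ℚᵘ.*≤* num≤num*den)))
  where
  k = ℤ.∣ num ∣
  p≤∣p∣ : ∀ p → p ≤ ∣ p ∣
  p≤∣p∣ p with ∣p∣≡p∨∣p∣≡-p p
  ... | inj₁ ∣p∣≡p = ≤-reflexive (sym ∣p∣≡p)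
  ... | inj₂ ∣p∣≡-p = ≤-trans (subst₂ _≤_ (trans (cong -_ ∣p∣≡-p) (neg-involutive p)) refl
                          (neg-antimono-≤ (0≤∣p∣ p))) (0≤∣p∣ p)
    where
    neg-involutive : ∀ p → - (- p) ≡ p
    neg-involutive = solve-∀ ℚring
  num≤num*den : pos k ℤ.* pos 1 ℤ.≤ pos k ℤ.* pos (suc d)
  num≤num*den = subst₂ ℤ._≤_ (ℤP.pos-* k 1) (ℤP.pos-* k (suc d)) (ℤ.+≤+ (ℕP.*-monoʳ-≤ k (s≤s z≤n)))

1/suc : ℕ → ℚ
1/suc n = (1/ ι (suc n)) {{pos⇒nonZero (ι (suc n)) {{positive (0<ι-suc n)}}}}

1/suc-inverse : ∀ n → 1/suc n * ι (suc n) ≡ 1ℚ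
1/suc-inverse n = *-inverseˡ (ι (suc n)) {{pos⇒nonZero (ι (suc n)) {{positive (0<ι-suc n)}}}}

0<1/suc : ∀ n → 0ℚ < 1/suc n
0<1/suc n = positive⁻¹ (1/suc n) {{1/pos⇒pos (ι (suc n)) {{positive (0<ι-suc n)}}}}

0≤1/suc : ∀ n → 0ℚ ≤ 1/suc n
0≤1/suc n = <⇒≤ (0<1/suc n)

*-1/suc : ∀ p n → ι (suc n) * (p * 1/suc n) ≡ p
*-1/suc p n = trans (swap (ι (suc n)) p (1/suc n)) (trans (cong (p *_) (1/suc-inverse n)) (*-identityʳ p))
  where
  swap : ∀ a b c → a * (b * c) ≡ b * (c * a)
  swap = solve-∀ ℚring

half+half : ∀ δ → δ * 1/suc 1 + δ * 1/suc 1 ≡ δ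
half+half δ = trans (sym (*-distribˡ-+ δ (1/suc 1) (1/suc 1))) (*-identityʳ δ)

≤δ*ι-eventually : ∀ c δ → 0ℚ < δ → Eventually (λ n → c ≤ δ * ι n)
≤δ*ι-eventually c δ 0<δ = N , λ n N≤n → begin
  c                    ≡⟨ sym (*-identityʳ c) ⟩
  c * 1ℚ               ≡⟨ cong (c *_) (sym (*-inverseʳ δ)) ⟩
  c * (δ * 1/ δ)       ≡⟨ swap c δ (1/ δ) ⟩
  δ * (c * 1/ δ)       ≤⟨ *-monoˡ-≤-0≤ (<⇒≤ 0<δ) (≤-trans (proj₂ (archimedean (c * 1/ δ))) (ι-mono-≤ N≤n)) ⟩
  δ * ι n              ∎
  where
  open ≤-Reasoning
  instance
    δ≢0 : NonZero δ
    δ≢0 = pos⇒nonZero δ {{positive 0<δ}}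
  N = proj₁ (archimedean (c * 1/ δ))
  swap : ∀ c δ i → c * (δ * i) ≡ δ * (c * i)
  swap = solve-∀ ℚring

*1/n-eventually-≤ : ∀ c δ → 0ℚ < δ →
  Eventually (λ n → ∀ r → 0ℚ ≤ r → r * ι n ≡ 1ℚ → c * r ≤ δ)
*1/n-eventually-≤ c δ 0<δ = eventually-map bound (≤δ*ι-eventually c δ 0<δ)
  where
  open ≤-Reasoning
  bound : ∀ n → c ≤ δ * ι n → ∀ r → 0ℚ ≤ r → r * ι n ≡ 1ℚ → c * r ≤ δ
  bound n c≤δn r 0≤r rn≡1 = begin
    c * r          ≤⟨ *-monoʳ-≤-0≤ 0≤r c≤δn ⟩
    δ * ι n * r    ≡⟨ trans (*-assoc δ (ι n) r) (cong (δ *_) (trans (*-comm (ι n) r) rn≡1)) ⟩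
    δ * 1ℚ         ≡⟨ *-identityʳ δ ⟩
    δ              ∎

ι*r≤1 : ∀ {i m r} → i ℕ.≤ m → 0ℚ ≤ r → r * ι m ≡ 1ℚ → ι i * r ≤ 1ℚ
ι*r≤1 {i} {m} {r} i≤m 0≤r rm≡1 =
  ≤-trans (*-monoʳ-≤-0≤ 0≤r (ι-mono-≤ i≤m)) (≤-reflexive (trans (*-comm (ι m) r) rm≡1))

pow-distribˡ-+-* : ∀ x m n → pow x (m ℕ.+ n) ≡ pow x m * pow x n
pow-distribˡ-+-* x zero    n = sym (*-identityˡ (pow x n))
pow-distribˡ-+-* x (suc m) n =
  trans (cong (x *_) (pow-distribˡ-+-* x m n)) (sym (*-assoc x (pow x m) (pow x n)))

pow-distribʳ-* : ∀ x y n → pow (x * y) n ≡ pow x n * pow y n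
pow-distribʳ-* x y zero    = refl
pow-distribʳ-* x y (suc n) = trans (cong ((x * y) *_) (pow-distribʳ-* x y n)) (interchange x y (pow x n) (pow y n))
  where
  interchange : ∀ a b c d → a * b * (c * d) ≡ a * c * (b * d)
  interchange = solve-∀ ℚring

pow-*-assoc : ∀ x m n → pow (pow x m) n ≡ pow x (m ℕ.* n)
pow-*-assoc x m zero    = cong (pow x) (sym (ℕP.*-zeroʳ m))
pow-*-assoc x m (suc n) = trans (cong (pow x m *_) (pow-*-assoc x m n))
  (trans (sym (pow-distribˡ-+-* x m (m ℕ.* n))) (cong (pow x) (sym (ℕP.*-suc m n))))

pow-1ℚ : ∀ n → pow 1ℚ n ≡ 1ℚ
pow-1ℚ zero    = refl
pow-1ℚ (suc n) = trans (*-identityˡ (pow 1ℚ n)) (pow-1ℚ n)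

ι-homo-^ : ∀ m n → ι (m ℕ.^ n) ≡ pow (ι m) n
ι-homo-^ m zero    = refl
ι-homo-^ m (suc n) = trans (ι-homo-* m (m ℕ.^ n)) (cong (ι m *_) (ι-homo-^ m n))

∣pow∣ : ∀ x n → ∣ pow x n ∣ ≡ pow ∣ x ∣ n
∣pow∣ x zero    = refl
∣pow∣ x (suc n) = trans (∣p*q∣≡∣p∣*∣q∣ x (pow x n)) (cong (∣ x ∣ *_) (∣pow∣ x n))

pow-nonNeg : ∀ {x} n → 0ℚ ≤ x → 0ℚ ≤ pow x n
pow-nonNeg zero    _   = 0≤1
pow-nonNeg (suc n) 0≤x = 0≤* 0≤x (pow-nonNeg n 0≤x)

pow-monoˡ-≤ : ∀ {x y} n → 0ℚ ≤ x → x ≤ y → pow x n ≤ pow y n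
pow-monoˡ-≤ zero    _   _   = ≤-refl
pow-monoˡ-≤ (suc n) 0≤x x≤y = *-mono-≤-0≤ 0≤x (pow-nonNeg n 0≤x) x≤y (pow-monoˡ-≤ n 0≤x x≤y)

pow-≤1 : ∀ {x} n → 0ℚ ≤ x → x ≤ 1ℚ → pow x n ≤ 1ℚ
pow-≤1 n 0≤x x≤1 = ≤-trans (pow-monoˡ-≤ n 0≤x x≤1) (≤-reflexive (pow-1ℚ n))

1≤pow : ∀ {x} n → 1ℚ ≤ x → 1ℚ ≤ pow x n
1≤pow n 1≤x = ≤-trans (≤-reflexive (sym (pow-1ℚ n))) (pow-monoˡ-≤ n 0≤1 1≤x)

pow-monoʳ-≤ : ∀ {x} m n → 1ℚ ≤ x → m ℕ.≤ n → pow x m ≤ pow x n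
pow-monoʳ-≤ {x} m n 1≤x m≤n = begin
  pow x m                      ≡⟨ sym (*-identityʳ (pow x m)) ⟩
  pow x m * 1ℚ                 ≤⟨ *-monoˡ-≤-0≤ (pow-nonNeg m (≤-trans 0≤1 1≤x)) (1≤pow (n ∸ m) 1≤x) ⟩
  pow x m * pow x (n ∸ m)      ≡⟨ sym (pow-distribˡ-+-* x m (n ∸ m)) ⟩
  pow x (m ℕ.+ (n ∸ m))        ≡⟨ cong (pow x) (ℕP.m+[n∸m]≡n m≤n) ⟩
  pow x n                      ∎
  where open ≤-Reasoning

∣pow∣≤ : ∀ {x B} n → ∣ x ∣ ≤ B → ∣ pow x n ∣ ≤ pow B n
∣pow∣≤ {x} n ∣x∣≤B = subst (_≤ _) (sym (∣pow∣ x n)) (pow-monoˡ-≤ n (0≤∣p∣ x) ∣x∣≤B)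

∣pow-pow∣≤ : ∀ {x y B} n → ∣ x ∣ ≤ B → ∣ y ∣ ≤ B → 1ℚ ≤ B →
  ∣ pow x n - pow y n ∣ ≤ ι n * pow B n * ∣ x - y ∣
∣pow-pow∣≤ {x} {y} {B} zero _ _ _ =
  ≤-reflexive (trans (cong ∣_∣ (+-inverseʳ 1ℚ)) (sym (*-zeroˡ ∣ x - y ∣)))
∣pow-pow∣≤ {x} {y} {B} (suc n) ∣x∣≤B ∣y∣≤B 1≤B = begin
  ∣ x * pow x n - y * pow y n ∣
    ≡⟨ cong ∣_∣ (telescope x y (pow x n) (pow y n)) ⟩
  ∣ x * (pow x n - pow y n) + pow y n * (x - y) ∣
    ≤⟨ ∣p+q∣≤∣p∣+∣q∣ (x * (pow x n - pow y n)) (pow y n * (x - y)) ⟩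
  ∣ x * (pow x n - pow y n) ∣ + ∣ pow y n * (x - y) ∣
    ≤⟨ +-mono-≤ (∣*∣-mono-≤ ∣x∣≤B (∣pow-pow∣≤ n ∣x∣≤B ∣y∣≤B 1≤B)) (∣*∣-mono-≤ (∣pow∣≤ n ∣y∣≤B) ≤-refl) ⟩
  B * (ι n * pow B n * ∣ x - y ∣) + pow B n * ∣ x - y ∣
    ≤⟨ +-monoʳ-≤ (B * (ι n * pow B n * ∣ x - y ∣)) (*-monoʳ-≤-0≤ (0≤∣p∣ (x - y)) Bⁿ≤B*Bⁿ) ⟩
  B * (ι n * pow B n * ∣ x - y ∣) + B * pow B n * ∣ x - y ∣
    ≡⟨ collect B (ι n) (pow B n) ∣ x - y ∣ ⟩
  (1ℚ + ι n) * (B * pow B n) * ∣ x - y ∣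
    ≡⟨ cong (λ z → z * (B * pow B n) * ∣ x - y ∣) (sym (ι-suc n)) ⟩
  ι (suc n) * (B * pow B n) * ∣ x - y ∣ ∎
  where
  open ≤-Reasoning
  telescope : ∀ x y a b → x * a - y * b ≡ x * (a - b) + b * (x - y)
  telescope = solve-∀ ℚring
  collect : ∀ B n P d → B * (n * P * d) + B * P * d ≡ (1ℚ + n) * (B * P) * d
  collect = solve-∀ ℚring
  Bⁿ≤B*Bⁿ : pow B n ≤ B * pow B n
  Bⁿ≤B*Bⁿ = subst (_≤ B * pow B n) (*-identityˡ (pow B n))
    (*-monoʳ-≤-0≤ (pow-nonNeg n (≤-trans 0≤1 1≤B)) 1≤B)

bernoulli : ∀ {c} k → 0ℚ ≤ c → c ≤ 1ℚ → 1ℚ - ι k * c ≤ pow (1ℚ - c) k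
bernoulli {c} zero _ _ = ≤-reflexive (drop c)
  where
  drop : ∀ c → 1ℚ - 0ℚ * c ≡ 1ℚ
  drop = solve-∀ ℚring
bernoulli {c} (suc k) 0≤c c≤1 = begin
  1ℚ - ι (suc k) * c             ≡⟨ cong (λ z → 1ℚ - z * c) (ι-suc k) ⟩
  1ℚ - (1ℚ + ι k) * c            ≤⟨ 0≤q-p⇒p≤q (subst (0ℚ ≤_) (gap (ι k) c) (0≤* (ι-nonNeg k) (0≤* 0≤c 0≤c))) ⟩
  (1ℚ - c) * (1ℚ - ι k * c)      ≤⟨ *-monoˡ-≤-0≤ (p≤q⇒0≤q-p c≤1) (bernoulli k 0≤c c≤1) ⟩
  (1ℚ - c) * pow (1ℚ - c) k      ∎
  where
  open ≤-Reasoning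
  gap : ∀ k c → k * (c * c) ≡ (1ℚ - c) * (1ℚ - k * c) - (1ℚ - (1ℚ + k) * c)
  gap = solve-∀ ℚring

∣1-jr-pow∣≤ : ∀ {r} j → 0ℚ ≤ r → r ≤ 1ℚ → ∣ (1ℚ - ι j * r) - pow (1ℚ - r) j ∣ ≤ ι (j ℕ.* j) * (r * r)
∣1-jr-pow∣≤ {r} zero _ _ = ≤-reflexive (trans (cong ∣_∣ (vanish r)) (sym (*-zeroˡ (r * r))))
  where
  vanish : ∀ r → 1ℚ - 0ℚ * r - 1ℚ ≡ 0ℚ
  vanish = solve-∀ ℚring
∣1-jr-pow∣≤ {r} (suc j) 0≤r r≤1 = begin
  ∣ (1ℚ - ι (suc j) * r) - (1ℚ - r) * P ∣
    ≡⟨ cong (λ w → ∣ (1ℚ - w * r) - (1ℚ - r) * P ∣) (ι-suc j) ⟩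
  ∣ (1ℚ - (1ℚ + ι j) * r) - (1ℚ - r) * P ∣
    ≡⟨ cong ∣_∣ (recurrence (ι j) r P) ⟩
  ∣ (1ℚ - r) * ((1ℚ - ι j * r) - P) + (- (ι j * (r * r))) ∣
    ≤⟨ ∣p+q∣≤∣p∣+∣q∣ ((1ℚ - r) * ((1ℚ - ι j * r) - P)) (- (ι j * (r * r))) ⟩
  ∣ (1ℚ - r) * ((1ℚ - ι j * r) - P) ∣ + ∣ - (ι j * (r * r)) ∣
    ≡⟨ cong (∣ (1ℚ - r) * ((1ℚ - ι j * r) - P) ∣ +_)
         (trans (∣-p∣≡∣p∣ (ι j * (r * r))) (0≤p⇒∣p∣≡p (0≤* (ι-nonNeg j) (0≤* 0≤r 0≤r)))) ⟩
  ∣ (1ℚ - r) * ((1ℚ - ι j * r) - P) ∣ + ι j * (r * r)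
    ≤⟨ +-monoˡ-≤ (ι j * (r * r)) (∣*∣-mono-≤ ∣1-r∣≤1 (∣1-jr-pow∣≤ j 0≤r r≤1)) ⟩
  1ℚ * (ι (j ℕ.* j) * (r * r)) + ι j * (r * r)
    ≡⟨ cong (λ w → 1ℚ * (w * (r * r)) + ι j * (r * r)) (ι-homo-* j j) ⟩
  1ℚ * (ι j * ι j * (r * r)) + ι j * (r * r)
    ≤⟨ 0≤q-p⇒p≤q (subst (0ℚ ≤_) (gap (ι j) r) (0≤* (+-mono-≤ (ι-nonNeg j) 0≤1) (0≤* 0≤r 0≤r))) ⟩
  (1ℚ + ι j) * (1ℚ + ι j) * (r * r)
    ≡⟨ cong (_* (r * r)) (sym (trans (ι-homo-* (suc j) (suc j)) (cong₂ _*_ (ι-suc j) (ι-suc j)))) ⟩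
  ι (suc j ℕ.* suc j) * (r * r) ∎
  where
  open ≤-Reasoning
  P = pow (1ℚ - r) j
  recurrence : ∀ J r P → (1ℚ - (1ℚ + J) * r) - (1ℚ - r) * P ≡ (1ℚ - r) * ((1ℚ - J * r) - P) + (- (J * (r * r)))
  recurrence = solve-∀ ℚring
  gap : ∀ J r → (J + 1ℚ) * (r * r) ≡ (1ℚ + J) * (1ℚ + J) * (r * r) - (1ℚ * (J * J * (r * r)) + J * (r * r))
  gap = solve-∀ ℚring
  ∣1-r∣≤1 : ∣ 1ℚ - r ∣ ≤ 1ℚ
  ∣1-r∣≤1 = ∣p∣≤1⇐0≤p≤1 (p≤q⇒0≤q-p r≤1) (0≤p⇒1-p≤1 0≤r)

∣pow-pow-+∣≤ : ∀ {c} e s → 0ℚ ≤ c → c ≤ 1ℚ → ∣ pow (1ℚ - c) e - pow (1ℚ - c) (e ℕ.+ s) ∣ ≤ ι s * c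
∣pow-pow-+∣≤ {c} e s 0≤c c≤1 = begin
  ∣ A - pow u (e ℕ.+ s) ∣      ≡⟨ cong (λ w → ∣ A - w ∣) (pow-distribˡ-+-* u e s) ⟩
  ∣ A - A * pow u s ∣          ≡⟨ cong ∣_∣ (factor A (pow u s)) ⟩
  ∣ A * (1ℚ - pow u s) ∣       ≡⟨ 0≤p⇒∣p∣≡p (0≤* 0≤A (p≤q⇒0≤q-p uˢ≤1)) ⟩
  A * (1ℚ - pow u s)           ≤⟨ *-mono-≤-0≤ 0≤A (p≤q⇒0≤q-p uˢ≤1) (pow-≤1 e 0≤u u≤1)
                                    (subst₂ _≤_ refl (cancel (ι s) c) (+-monoʳ-≤ 1ℚ (neg-antimono-≤ (bernoulli s 0≤c c≤1)))) ⟩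
  1ℚ * (ι s * c)               ≡⟨ *-identityˡ _ ⟩
  ι s * c                      ∎
  where
  open ≤-Reasoning
  u = 1ℚ - c
  A = pow u e
  0≤u = p≤q⇒0≤q-p c≤1
  u≤1 = 0≤p⇒1-p≤1 0≤c
  0≤A = pow-nonNeg e 0≤u
  uˢ≤1 = pow-≤1 s 0≤u u≤1
  factor : ∀ A P → A - A * P ≡ A * (1ℚ - P)
  factor = solve-∀ ℚring
  cancel : ∀ s c → 1ℚ - (1ℚ - s * c) ≡ s * c
  cancel = solve-∀ ℚring

sumℚ-cong : ∀ n {f g : ℕ → ℚ} → (∀ i → i ℕ.< n → f i ≡ g i) → sumℚ n f ≡ sumℚ n g
sumℚ-cong zero    _ = refl
sumℚ-cong (suc n) h = cong₂ _+_ (sumℚ-cong n (λ i i<n → h i (ℕP.m<n⇒m<1+n i<n))) (h n ℕP.≤-refl)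

sumℚ-nonNeg : ∀ n {f : ℕ → ℚ} → (∀ i → i ℕ.< n → 0ℚ ≤ f i) → 0ℚ ≤ sumℚ n f
sumℚ-nonNeg zero    _ = ≤-refl
sumℚ-nonNeg (suc n) h = +-mono-≤ (sumℚ-nonNeg n (λ i i<n → h i (ℕP.m<n⇒m<1+n i<n))) (h n ℕP.≤-refl)

sumℚ-distrib-+ : ∀ n (f g : ℕ → ℚ) → sumℚ n (λ i → f i + g i) ≡ sumℚ n f + sumℚ n g
sumℚ-distrib-+ zero    f g = refl
sumℚ-distrib-+ (suc n) f g =
  trans (cong (_+ (f n + g n)) (sumℚ-distrib-+ n f g)) (interchange (sumℚ n f) (sumℚ n g) (f n) (g n))
  where
  interchange : ∀ a b c d → a + b + (c + d) ≡ a + c + (b + d)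
  interchange = solve-∀ ℚring

sumℚ-distrib-neg : ∀ n (f : ℕ → ℚ) → sumℚ n (λ i → - f i) ≡ - sumℚ n f
sumℚ-distrib-neg zero    f = refl
sumℚ-distrib-neg (suc n) f =
  trans (cong (_+ - f n) (sumℚ-distrib-neg n f)) (sym (neg-distrib-+ (sumℚ n f) (f n)))

sumℚ-distrib-- : ∀ n (f g : ℕ → ℚ) → sumℚ n (λ i → f i - g i) ≡ sumℚ n f - sumℚ n g
sumℚ-distrib-- n f g = trans (sumℚ-distrib-+ n f (λ i → - g i)) (cong (sumℚ n f +_) (sumℚ-distrib-neg n g))

*-distribˡ-sumℚ : ∀ n c (f : ℕ → ℚ) → sumℚ n (λ i → c * f i) ≡ c * sumℚ n f
*-distribˡ-sumℚ zero    c f = sym (*-zeroʳ c)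
*-distribˡ-sumℚ (suc n) c f =
  trans (cong (_+ c * f n) (*-distribˡ-sumℚ n c f)) (sym (*-distribˡ-+ c (sumℚ n f) (f n)))

sumℚ-const : ∀ n c → sumℚ n (λ _ → c) ≡ ι n * c
sumℚ-const zero    c = sym (*-zeroˡ c)
sumℚ-const (suc n) c = trans (cong (_+ c) (sumℚ-const n c)) (trans (absorb (ι n) c) (cong (_* c) (sym (ι-suc n))))
  where
  absorb : ∀ n c → n * c + c ≡ (1ℚ + n) * c
  absorb = solve-∀ ℚring

∣sumℚ∣≤sumℚ : ∀ n (f c : ℕ → ℚ) → (∀ i → i ℕ.< n → ∣ f i ∣ ≤ c i) → ∣ sumℚ n f ∣ ≤ sumℚ n c
∣sumℚ∣≤sumℚ zero    f c _ = ≤-refl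
∣sumℚ∣≤sumℚ (suc n) f c h = ≤-trans (∣p+q∣≤∣p∣+∣q∣ (sumℚ n f) (f n))
  (+-mono-≤ (∣sumℚ∣≤sumℚ n f c (λ i i<n → h i (ℕP.m<n⇒m<1+n i<n))) (h n ℕP.≤-refl))

sumℚ-split : ∀ K n (f : ℕ → ℚ) → sumℚ (K ℕ.+ n) f ≡ sumℚ K f + sumℚ n (λ i → f (K ℕ.+ i))
sumℚ-split K zero    f = trans (cong (λ z → sumℚ z f) (ℕP.+-identityʳ K)) (sym (+-identityʳ (sumℚ K f)))
sumℚ-split K (suc n) f = trans (cong (λ z → sumℚ z f) (ℕP.+-suc K n))
  (trans (cong (_+ f (K ℕ.+ n)) (sumℚ-split K n f)) (+-assoc (sumℚ K f) _ (f (K ℕ.+ n))))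

sumℚ-split-≤ : ∀ {K n} (f : ℕ → ℚ) → K ℕ.≤ n → sumℚ n f ≡ sumℚ K f + sumℚ (n ∸ K) (λ i → f (K ℕ.+ i))
sumℚ-split-≤ {K} {n} f K≤n =
  trans (cong (λ z → sumℚ z f) (sym (ℕP.m+[n∸m]≡n K≤n))) (sumℚ-split K (n ∸ K) f)

sumℚ-shift : ∀ n (f : ℕ → ℚ) → sumℚ (suc n) f ≡ f 0 + sumℚ n (λ i → f (suc i))
sumℚ-shift n f = trans (sumℚ-split 1 n f) (cong (_+ sumℚ n (λ i → f (suc i))) (+-identityˡ (f 0)))

sumℚ-mono-length : ∀ {m n} (f : ℕ → ℚ) → (∀ i → 0ℚ ≤ f i) → m ℕ.≤ n → sumℚ m f ≤ sumℚ n f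
sumℚ-mono-length {m} {n} f 0≤f m≤n = begin
  sumℚ m f                                         ≡⟨ sym (+-identityʳ (sumℚ m f)) ⟩
  sumℚ m f + 0ℚ                                    ≤⟨ +-monoʳ-≤ (sumℚ m f) (sumℚ-nonNeg (n ∸ m) (λ i _ → 0≤f (m ℕ.+ i))) ⟩
  sumℚ m f + sumℚ (n ∸ m) (λ i → f (m ℕ.+ i))      ≡⟨ sym (sumℚ-split-≤ f m≤n) ⟩
  sumℚ n f                                         ∎
  where open ≤-Reasoning

sumℚ-reverse : ∀ n (g : ℕ → ℚ) → sumℚ n g ≡ sumℚ n (λ j → g (n ∸ suc j))
sumℚ-reverse zero    g = refl
sumℚ-reverse (suc n) g = begin
  sumℚ n g + g n                        ≡⟨ +-comm (sumℚ n g) (g n) ⟩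
  g n + sumℚ n g                        ≡⟨ cong (g n +_) (sumℚ-reverse n g) ⟩
  g n + sumℚ n (λ j → g (n ∸ suc j))    ≡⟨ sym (sumℚ-shift n (λ j → g (n ∸ j))) ⟩
  sumℚ (suc n) (λ j → g (n ∸ j))        ∎
  where open ≡-Reasoning

-- The exponential series

*-inverse-unique : ∀ {a b c} → a * c ≡ 1ℚ → b * c ≡ 1ℚ → a ≡ b
*-inverse-unique {a} {b} {c} ac≡1 bc≡1 = begin
  a              ≡⟨ sym (*-identityʳ a) ⟩
  a * 1ℚ         ≡⟨ cong (a *_) (sym bc≡1) ⟩
  a * (b * c)    ≡⟨ swap a b c ⟩
  b * (a * c)    ≡⟨ cong (b *_) ac≡1 ⟩
  b * 1ℚ         ≡⟨ *-identityʳ b ⟩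
  b              ∎
  where
  open ≡-Reasoning
  swap : ∀ a b c → a * (b * c) ≡ b * (a * c)
  swap = solve-∀ ℚring

invFact-inverse : ∀ j → invFact j * ι (j !) ≡ 1ℚ
invFact-inverse j with j ! | j ℕP.!≢0
... | suc d | _ = frac-*-denominator 1 d

invFact-suc : ∀ j → invFact (suc j) * ι (suc j) ≡ invFact j
invFact-suc j = *-inverse-unique (trans (*-assoc (invFact (suc j)) (ι (suc j)) (ι (j !)))
  (trans (cong (invFact (suc j) *_) (sym (ι-homo-* (suc j) (j !)))) (invFact-inverse (suc j))))
  (invFact-inverse j)

invFact-nonNeg : ∀ j → 0ℚ ≤ invFact j
invFact-nonNeg j = nonNegative⁻¹ (invFact j) {{normalize-nonNeg 1 (j !) {{j ℕP.!≢0}}}}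

invFact-≤1 : ∀ j → invFact j ≤ 1ℚ
invFact-≤1 zero    = ≤-refl
invFact-≤1 (suc j) = begin
  invFact (suc j)                 ≡⟨ sym (*-identityʳ (invFact (suc j))) ⟩
  invFact (suc j) * 1ℚ            ≤⟨ *-monoˡ-≤-0≤ (invFact-nonNeg (suc j)) (1≤ι-suc j) ⟩
  invFact (suc j) * ι (suc j)     ≡⟨ invFact-suc j ⟩
  invFact j                       ≤⟨ invFact-≤1 j ⟩
  1ℚ                              ∎
  where open ≤-Reasoning

expTerm : ℚ → ℕ → ℚ
expTerm y i = pow y i * invFact i

-- xTrunc M = expSum M (- 1ℚ) and LTrunc M = expSum M (- xTrunc M) hold definitionally.
expSum : ℕ → ℚ → ℚ
expSum M y = sumℚ M (expTerm y)

expTerm-nonNeg : ∀ {y} i → 0ℚ ≤ y → 0ℚ ≤ expTerm y i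
expTerm-nonNeg i 0≤y = 0≤* (pow-nonNeg i 0≤y) (invFact-nonNeg i)

∣expTerm∣≤ : ∀ {y B} i → ∣ y ∣ ≤ B → ∣ expTerm y i ∣ ≤ expTerm B i
∣expTerm∣≤ {y} {B} i ∣y∣≤B = begin
  ∣ pow y i * invFact i ∣             ≡⟨ ∣p*q∣≡∣p∣*∣q∣ (pow y i) (invFact i) ⟩
  ∣ pow y i ∣ * ∣ invFact i ∣         ≡⟨ cong (∣ pow y i ∣ *_) (0≤p⇒∣p∣≡p (invFact-nonNeg i)) ⟩
  ∣ pow y i ∣ * invFact i             ≤⟨ *-monoʳ-≤-0≤ (invFact-nonNeg i) (∣pow∣≤ i ∣y∣≤B) ⟩
  pow B i * invFact i                 ∎
  where open ≤-Reasoning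

expTerm-suc : ∀ y i → ι (suc i) * expTerm y (suc i) ≡ y * expTerm y i
expTerm-suc y i = trans (regroup (ι (suc i)) y (pow y i) (invFact (suc i)))
  (cong (λ z → y * (pow y i * z)) (invFact-suc i))
  where
  regroup : ∀ s t P F → s * (t * P * F) ≡ t * (P * (F * s))
  regroup = solve-∀ ℚring

expTerm-halving : ∀ {y} K → 0ℚ ≤ y → ι 2 * y ≤ ι (suc K) →
  ∀ i → K ℕ.≤ i → ι 2 * expTerm y (suc i) ≤ expTerm y i
expTerm-halving {y} K 0≤y 2y≤K+1 i K≤i = *-cancelˡ-≤-pos (ι (suc i)) {{positive (0<ι-suc i)}} (begin
  ι (suc i) * (ι 2 * expTerm y (suc i))   ≡⟨ swap (ι (suc i)) (ι 2) (expTerm y (suc i)) ⟩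
  ι 2 * (ι (suc i) * expTerm y (suc i))   ≡⟨ cong (ι 2 *_) (expTerm-suc y i) ⟩
  ι 2 * (y * expTerm y i)                 ≡⟨ sym (*-assoc (ι 2) y (expTerm y i)) ⟩
  ι 2 * y * expTerm y i                   ≤⟨ *-monoʳ-≤-0≤ (expTerm-nonNeg i 0≤y) (≤-trans 2y≤K+1 (ι-mono-≤ (s≤s K≤i))) ⟩
  ι (suc i) * expTerm y i                 ∎)
  where
  open ≤-Reasoning
  swap : ∀ a b c → a * (b * c) ≡ b * (a * c)
  swap = solve-∀ ℚring

geometric-tail : ∀ (g : ℕ → ℚ) K → (∀ i → 0ℚ ≤ g i) → (∀ i → K ℕ.≤ i → ι 2 * g (suc i) ≤ g i) →
  ∀ len L → K ℕ.≤ L → sumℚ len (λ i → g (L ℕ.+ i)) ≤ ι 2 * g L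
geometric-tail g K 0≤g halving zero    L K≤L = 0≤* (ι-nonNeg 2) (0≤g L)
geometric-tail g K 0≤g halving (suc len) L K≤L = begin
  sumℚ (suc len) (λ i → g (L ℕ.+ i))
    ≡⟨ sumℚ-shift len (λ i → g (L ℕ.+ i)) ⟩
  g (L ℕ.+ 0) + sumℚ len (λ i → g (L ℕ.+ suc i))
    ≡⟨ cong₂ _+_ (cong g (ℕP.+-identityʳ L)) (sumℚ-cong len (λ i _ → cong g (ℕP.+-suc L i))) ⟩
  g L + sumℚ len (λ i → g (suc L ℕ.+ i))
    ≤⟨ +-monoʳ-≤ (g L) (geometric-tail g K 0≤g halving len (suc L) (ℕP.m≤n⇒m≤1+n K≤L)) ⟩
  g L + ι 2 * g (suc L)
    ≤⟨ +-monoʳ-≤ (g L) (halving L K≤L) ⟩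
  g L + g L
    ≡⟨ double (g L) ⟩
  ι 2 * g L ∎
  where
  open ≤-Reasoning
  double : ∀ a → a + a ≡ ι 2 * a
  double = solve-∀ ℚring

sumℚ≤-geometric : ∀ (g : ℕ → ℚ) K → (∀ i → 0ℚ ≤ g i) → (∀ i → K ℕ.≤ i → ι 2 * g (suc i) ≤ g i) →
  ∀ M → sumℚ M g ≤ sumℚ K g + ι 2 * g K
sumℚ≤-geometric g K 0≤g halving M = begin
  sumℚ M g                                      ≤⟨ sumℚ-mono-length g 0≤g (ℕP.m≤n+m M K) ⟩
  sumℚ (K ℕ.+ M) g                              ≡⟨ sumℚ-split K M g ⟩
  sumℚ K g + sumℚ M (λ i → g (K ℕ.+ i))         ≤⟨ +-monoʳ-≤ (sumℚ K g) (geometric-tail g K 0≤g halving M K ℕP.≤-refl) ⟩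
  sumℚ K g + ι 2 * g K                          ∎
  where open ≤-Reasoning

-- Every argument below is at most 3 in absolute value (see ∣xTrunc∣≤3), so the series at 3 dominates.
expTerm₃ : ℕ → ℚ
expTerm₃ = expTerm (ι 3)

expTerm₃-nonNeg : ∀ i → 0ℚ ≤ expTerm₃ i
expTerm₃-nonNeg i = expTerm-nonNeg i (ι-nonNeg 3)

expTerm₃-halving : ∀ i → 5 ℕ.≤ i → ι 2 * expTerm₃ (suc i) ≤ expTerm₃ i
expTerm₃-halving = expTerm-halving 5 (ι-nonNeg 3) (≤ᵇ⇒≤ _)

expTerm₃-tail : ∀ len K → 5 ℕ.≤ K → sumℚ len (λ i → expTerm₃ (K ℕ.+ i)) ≤ ι 2 * expTerm₃ K
expTerm₃-tail = geometric-tail expTerm₃ 5 expTerm₃-nonNeg expTerm₃-halving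

sumℚ-expTerm₃≤21 : ∀ M → sumℚ M expTerm₃ ≤ ι 21
sumℚ-expTerm₃≤21 M = ≤-trans (sumℚ≤-geometric expTerm₃ 5 expTerm₃-nonNeg expTerm₃-halving M) (≤ᵇ⇒≤ _)

∣expSum∣≤21 : ∀ {y} M → ∣ y ∣ ≤ ι 3 → ∣ expSum M y ∣ ≤ ι 21
∣expSum∣≤21 {y} M ∣y∣≤3 =
  ≤-trans (∣sumℚ∣≤sumℚ M (expTerm y) expTerm₃ (λ i _ → ∣expTerm∣≤ i ∣y∣≤3)) (sumℚ-expTerm₃≤21 M)

expTerm₃-decreasing : ∀ i k → 5 ℕ.≤ i → expTerm₃ (k ℕ.+ i) ≤ expTerm₃ i
expTerm₃-decreasing i zero    5≤i = ≤-refl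
expTerm₃-decreasing i (suc k) 5≤i =
  ≤-trans (halving⇒≤ (expTerm₃-nonNeg (suc (k ℕ.+ i))) (expTerm₃-halving (k ℕ.+ i) (ℕP.≤-trans 5≤i (ℕP.m≤n+m i k))))
    (expTerm₃-decreasing i k 5≤i)
  where
  halving⇒≤ : ∀ {a b} → 0ℚ ≤ a → ι 2 * a ≤ b → a ≤ b
  halving⇒≤ {a} 0≤a 2a≤b = ≤-trans (subst₂ _≤_ (*-identityˡ a) refl (*-monoʳ-≤-0≤ 0≤a (ι-mono-≤ {1} {2} (s≤s z≤n)))) 2a≤b

3t₃[5]≤9 : ι 3 * expTerm₃ 5 ≤ ι 9
3t₃[5]≤9 = ≤ᵇ⇒≤ _

-- (i + 1) t₃(i + 1) = 3 t₃(i) ≤ 3 t₃(5) ≤ 9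
expTerm₃→0 : ∀ δ → 0ℚ < δ → Eventually (λ K → expTerm₃ K ≤ δ)
expTerm₃→0 δ 0<δ = suc (N ℕ.+ 5) , bound
  where
  open ≤-Reasoning
  N = proj₁ (≤δ*ι-eventually (ι 9) δ 0<δ)
  9≤δn = proj₂ (≤δ*ι-eventually (ι 9) δ 0<δ)
  bound : ∀ K → suc (N ℕ.+ 5) ℕ.≤ K → expTerm₃ K ≤ δ
  bound (suc i) (s≤s N+5≤i) = *-cancelʳ-≤-pos (ι (suc i)) {{positive (0<ι-suc i)}} (begin
    expTerm₃ (suc i) * ι (suc i)     ≡⟨ *-comm (expTerm₃ (suc i)) (ι (suc i)) ⟩
    ι (suc i) * expTerm₃ (suc i)     ≡⟨ expTerm-suc (ι 3) i ⟩
    ι 3 * expTerm₃ i                 ≤⟨ *-monoˡ-≤-0≤ (ι-nonNeg 3) t₃i≤t₃5 ⟩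
    ι 3 * expTerm₃ 5                 ≤⟨ 3t₃[5]≤9 ⟩
    ι 9                              ≤⟨ 9≤δn (suc i) (ℕP.≤-trans (ℕP.m≤m+n N 5) (ℕP.m≤n⇒m≤1+n N+5≤i)) ⟩
    δ * ι (suc i)                    ∎)
    where
    5≤i = ℕP.≤-trans (ℕP.m≤n+m 5 N) N+5≤i
    t₃i≤t₃5 : expTerm₃ i ≤ expTerm₃ 5
    t₃i≤t₃5 = subst (λ z → expTerm₃ z ≤ expTerm₃ 5) (ℕP.m∸n+n≡m 5≤i) (expTerm₃-decreasing 5 (i ∸ 5) ℕP.≤-refl)

∣xTrunc∣≤3 : ∀ M → ∣ xTrunc M ∣ ≤ ι 3
∣xTrunc∣≤3 M = ≤-trans (∣sumℚ∣≤sumℚ M (expTerm (- 1ℚ)) (expTerm 1ℚ) (λ i _ → ∣expTerm∣≤ i ≤-refl))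
  (≤-trans (sumℚ≤-geometric (expTerm 1ℚ) 1 (λ i → expTerm-nonNeg i 0≤1) (expTerm-halving 1 0≤1 (≤ᵇ⇒≤ _)) M) (≤ᵇ⇒≤ _))

nCk*k!≡nP′k : ∀ {n k} → k ℕ.≤ n → (n C k) ℕ.* (k !) ≡ n P′ k
nCk*k!≡nP′k {n} {k} k≤n = trans (cong (ℕ._* k !) (nCk≡nPk/k! k≤n))
  (trans (cong (λ z → (z ℕ./ k !) {{k ℕP.!≢0}} ℕ.* k !) nPk≡nP′k) (m/n*n≡m {{k ℕP.!≢0}} (k!∣nP′k k≤n)))
  where
  nPk≡nP′k : n Combinatorics.P k ≡ n P′ k
  nPk≡nP′k with k ℕ.≤ᵇ n | ℕP.≤⇒≤ᵇ k≤n
  ... | true | _ = refl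

binomial : ∀ z m → pow (1ℚ + z) m ≡ sumℚ (suc m) (λ i → ι (m C i) * pow z i)
binomial z zero    = refl
binomial z (suc m) = begin
  (1ℚ + z) * pow (1ℚ + z) m
    ≡⟨ cong ((1ℚ + z) *_) (binomial z m) ⟩
  (1ℚ + z) * sumℚ (suc m) c
    ≡⟨ *-distribʳ-+ (sumℚ (suc m) c) 1ℚ z ⟩
  1ℚ * sumℚ (suc m) c + z * sumℚ (suc m) c
    ≡⟨ cong₂ _+_ (trans (*-identityˡ _) (sumℚ-shift m c)) (sym (*-distribˡ-sumℚ (suc m) z c)) ⟩
  (c 0 + sumℚ m (λ i → c (suc i))) + sumℚ (suc m) (λ i → z * c i)
    ≡⟨ cong (λ w → (c 0 + w) + sumℚ (suc m) (λ i → z * c i)) vanishing-top ⟩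
  (c 0 + sumℚ (suc m) (λ i → c (suc i))) + sumℚ (suc m) (λ i → z * c i)
    ≡⟨ +-assoc (c 0) (sumℚ (suc m) (λ i → c (suc i))) (sumℚ (suc m) (λ i → z * c i)) ⟩
  c 0 + (sumℚ (suc m) (λ i → c (suc i)) + sumℚ (suc m) (λ i → z * c i))
    ≡⟨ cong (c 0 +_) (sym (sumℚ-distrib-+ (suc m) (λ i → c (suc i)) (λ i → z * c i))) ⟩
  c 0 + sumℚ (suc m) (λ i → c (suc i) + z * c i)
    ≡⟨ cong (c 0 +_) (sumℚ-cong (suc m) (λ i _ → pascal i)) ⟩
  c 0 + sumℚ (suc m) (λ i → d (suc i))
    ≡⟨ sym (sumℚ-shift (suc m) d) ⟩
  sumℚ (suc (suc m)) d ∎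
  where
  open ≡-Reasoning
  c d : ℕ → ℚ
  c i = ι (m C i) * pow z i
  d i = ι (suc m C i) * pow z i
  vanishing-top : sumℚ m (λ i → c (suc i)) ≡ sumℚ (suc m) (λ i → c (suc i))
  vanishing-top = sym (trans (cong (sumℚ m (λ i → c (suc i)) +_)
    (trans (cong (λ w → ι w * pow z (suc m)) (k>n⇒nCk≡0 (ℕP.n<1+n m))) (*-zeroˡ (pow z (suc m)))))
    (+-identityʳ _))
  collect : ∀ A B z P → A * (z * P) + z * (B * P) ≡ (B + A) * (z * P)
  collect = solve-∀ ℚring
  pascal : ∀ i → c (suc i) + z * c i ≡ d (suc i)
  pascal i = trans (collect (ι (m C suc i)) (ι (m C i)) z (pow z i))
    (cong (_* pow z (suc i)) (trans (sym (ι-homo-+ (m C i) (m C suc i))) (cong ι (nCk+nC[k+1]≡[n+1]C[k+1] m i))))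

-- With r = 1/m, falling r i = m (m - 1) ⋯ (m - i + 1) / m^i.
falling : ℚ → ℕ → ℚ
falling r zero    = 1ℚ
falling r (suc i) = falling r i * (1ℚ - ι i * r)

ι[m∸i]*r≡1-ι[i]*r : ∀ {m i r} → i ℕ.≤ m → r * ι m ≡ 1ℚ → ι (m ∸ i) * r ≡ 1ℚ - ι i * r
ι[m∸i]*r≡1-ι[i]*r {m} {i} {r} i≤m rm≡1 = begin
  ι (m ∸ i) * r                            ≡⟨ split (ι (m ∸ i)) (ι i) r ⟩
  (ι (m ∸ i) + ι i) * r - ι i * r          ≡⟨ cong (λ w → w * r - ι i * r) (ι-homo-∸ i≤m) ⟩
  ι m * r - ι i * r                        ≡⟨ cong (_- ι i * r) (trans (*-comm (ι m) r) rm≡1) ⟩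
  1ℚ - ι i * r                             ∎
  where
  open ≡-Reasoning
  split : ∀ A I r → A * r ≡ (A + I) * r - I * r
  split = solve-∀ ℚring

ι-P′≡falling : ∀ {m r} → r * ι m ≡ 1ℚ → ∀ i → i ℕ.≤ m → ι (m P′ i) * pow r i ≡ falling r i
ι-P′≡falling {m} {r} rm≡1 zero    _     = refl
ι-P′≡falling {m} {r} rm≡1 (suc i) i<m = begin
  ι ((m ∸ i) ℕ.* (m P′ i)) * (r * pow r i)   ≡⟨ cong (_* (r * pow r i)) (ι-homo-* (m ∸ i) (m P′ i)) ⟩
  ι (m ∸ i) * ι (m P′ i) * (r * pow r i)     ≡⟨ regroup (ι (m ∸ i)) (ι (m P′ i)) r (pow r i) ⟩
  ι (m P′ i) * pow r i * (ι (m ∸ i) * r)     ≡⟨ cong₂ _*_ (ι-P′≡falling rm≡1 i i≤m) (ι[m∸i]*r≡1-ι[i]*r i≤m rm≡1) ⟩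
  falling r i * (1ℚ - ι i * r)               ∎
  where
  open ≡-Reasoning
  i≤m = ℕP.<⇒≤ i<m
  regroup : ∀ A P r Q → A * P * (r * Q) ≡ P * Q * (A * r)
  regroup = solve-∀ ℚring

ι-C*pow≡invFact*falling : ∀ {m r} j → r * ι m ≡ 1ℚ → j ℕ.≤ m → ι (m C j) * pow r j ≡ invFact j * falling r j
ι-C*pow≡invFact*falling {m} {r} j rm≡1 j≤m = begin
  ι (m C j) * pow r j                             ≡⟨ sym (*-identityʳ _) ⟩
  ι (m C j) * pow r j * 1ℚ                        ≡⟨ cong (ι (m C j) * pow r j *_) (sym (invFact-inverse j)) ⟩
  ι (m C j) * pow r j * (invFact j * ι (j !))     ≡⟨ regroup (ι (m C j)) (pow r j) (invFact j) (ι (j !)) ⟩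
  invFact j * (ι (m C j) * ι (j !) * pow r j)     ≡⟨ cong (λ w → invFact j * (w * pow r j))
                                                        (trans (sym (ι-homo-* (m C j) (j !))) (cong ι (nCk*k!≡nP′k j≤m))) ⟩
  invFact j * (ι (m P′ j) * pow r j)              ≡⟨ cong (invFact j *_) (ι-P′≡falling rm≡1 j j≤m) ⟩
  invFact j * falling r j                         ∎
  where
  open ≡-Reasoning
  regroup : ∀ c p f g → c * p * (f * g) ≡ f * (c * g * p)
  regroup = solve-∀ ℚring

falling-bounds : ∀ {r} i → 0ℚ ≤ r → ι i * r ≤ 1ℚ →
  (0ℚ ≤ falling r i) × (falling r i ≤ 1ℚ) × (1ℚ - ι (i ℕ.* i) * r ≤ falling r i)
falling-bounds {r} zero _ _ = 0≤1 , ≤-refl , ≤-reflexive (drop r)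
  where
  drop : ∀ r → 1ℚ - 0ℚ * r ≡ 1ℚ
  drop = solve-∀ ℚring
falling-bounds {r} (suc i) 0≤r [i+1]r≤1 =
  0≤* 0≤f 0≤1-ir , ≤-trans (*-mono-≤-0≤ 0≤f 0≤1-ir f≤1 (0≤p⇒1-p≤1 0≤ir)) (≤-reflexive (*-identityˡ 1ℚ)) , lower
  where
  open ≤-Reasoning
  ir≤1 : ι i * r ≤ 1ℚ
  ir≤1 = ≤-trans (*-monoʳ-≤-0≤ 0≤r (ι-mono-≤ (ℕP.n≤1+n i))) [i+1]r≤1
  f = falling r i
  0≤f = proj₁ (falling-bounds i 0≤r ir≤1)
  f≤1 = proj₁ (proj₂ (falling-bounds i 0≤r ir≤1))
  1-i²r≤f = proj₂ (proj₂ (falling-bounds i 0≤r ir≤1))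
  0≤ir = 0≤* (ι-nonNeg i) 0≤r
  0≤1-ir = p≤q⇒0≤q-p ir≤1
  expand : ∀ I r → (1ℚ + I) * (1ℚ + I) * r ≡ I * I * r + I * r + (I + 1ℚ) * r
  expand = solve-∀ ℚring
  gap : ∀ I r → (I + 1ℚ) * r ≡ (1ℚ - I * I * r - I * r) - (1ℚ - (I * I * r + I * r + (I + 1ℚ) * r))
  gap = solve-∀ ℚring
  distrib : ∀ F a → F * (1ℚ - a) ≡ F - F * a
  distrib = solve-∀ ℚring
  lower : 1ℚ - ι (suc i ℕ.* suc i) * r ≤ f * (1ℚ - ι i * r)
  lower = begin
    1ℚ - ι (suc i ℕ.* suc i) * r
      ≡⟨ cong (λ w → 1ℚ - w * r) (trans (ι-homo-* (suc i) (suc i)) (cong₂ _*_ (ι-suc i) (ι-suc i))) ⟩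
    1ℚ - (1ℚ + ι i) * (1ℚ + ι i) * r
      ≡⟨ cong (λ w → 1ℚ - w) (expand (ι i) r) ⟩
    1ℚ - (ι i * ι i * r + ι i * r + (ι i + 1ℚ) * r)
      ≤⟨ 0≤q-p⇒p≤q (subst (0ℚ ≤_) (gap (ι i) r) (0≤* (+-mono-≤ (ι-nonNeg i) 0≤1) 0≤r)) ⟩
    1ℚ - ι i * ι i * r - ι i * r
      ≡⟨ cong (λ w → 1ℚ - w * r - ι i * r) (sym (ι-homo-* i i)) ⟩
    1ℚ - ι (i ℕ.* i) * r - ι i * r
      ≤⟨ +-monoˡ-≤ (- (ι i * r)) 1-i²r≤f ⟩
    f - ι i * r
      ≤⟨ +-monoʳ-≤ f (neg-antimono-≤ (subst (f * (ι i * r) ≤_) (*-identityˡ (ι i * r)) (*-monoʳ-≤-0≤ 0≤ir f≤1))) ⟩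
    f - f * (ι i * r)
      ≡⟨ sym (distrib f (ι i * r)) ⟩
    f * (1ℚ - ι i * r) ∎

∣falling∣≤1 : ∀ {r} i → 0ℚ ≤ r → ι i * r ≤ 1ℚ → ∣ falling r i ∣ ≤ 1ℚ
∣falling∣≤1 i 0≤r ir≤1 = ∣p∣≤1⇐0≤p≤1 (proj₁ bounds) (proj₁ (proj₂ bounds))
  where bounds = falling-bounds i 0≤r ir≤1

∣falling-1∣≤ : ∀ {r} i → 0ℚ ≤ r → ι i * r ≤ 1ℚ → ∣ falling r i - 1ℚ ∣ ≤ ι (i ℕ.* i) * r
∣falling-1∣≤ {r} i 0≤r ir≤1 = ∣p∣≤q⇐-q≤p≤q lower upper
  where
  bounds = falling-bounds i 0≤r ir≤1
  upper : falling r i - 1ℚ ≤ ι (i ℕ.* i) * r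
  upper = ≤-trans (subst (falling r i - 1ℚ ≤_) (+-inverseʳ 1ℚ) (+-monoˡ-≤ (- 1ℚ) (proj₁ (proj₂ bounds))))
    (0≤* (ι-nonNeg (i ℕ.* i)) 0≤r)
  shift : ∀ a → 1ℚ - a - 1ℚ ≡ - a
  shift = solve-∀ ℚring
  lower : - (ι (i ℕ.* i) * r) ≤ falling r i - 1ℚ
  lower = subst (_≤ falling r i - 1ℚ) (shift (ι (i ℕ.* i) * r)) (+-monoˡ-≤ (- 1ℚ) (proj₂ (proj₂ bounds)))

[1+yr]ᵐ≡sumℚ : ∀ {r} m y → r * ι m ≡ 1ℚ →
  pow (1ℚ + y * r) m ≡ sumℚ (suc m) (λ i → falling r i * expTerm y i)
[1+yr]ᵐ≡sumℚ {r} m y rm≡1 = trans (binomial (y * r) m) (sumℚ-cong (suc m) λ i i≤m → term i (ℕP.≤-pred i≤m))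
  where
  open ≡-Reasoning
  swap : ∀ C a b → C * (a * b) ≡ C * b * a
  swap = solve-∀ ℚring
  regroup : ∀ a f p → a * f * p ≡ f * (p * a)
  regroup = solve-∀ ℚring
  term : ∀ i → i ℕ.≤ m → ι (m C i) * pow (y * r) i ≡ falling r i * expTerm y i
  term i i≤m = begin
    ι (m C i) * pow (y * r) i              ≡⟨ cong (ι (m C i) *_) (pow-distribʳ-* y r i) ⟩
    ι (m C i) * (pow y i * pow r i)        ≡⟨ swap (ι (m C i)) (pow y i) (pow r i) ⟩
    ι (m C i) * pow r i * pow y i          ≡⟨ cong (_* pow y i) (ι-C*pow≡invFact*falling i rm≡1 i≤m) ⟩
    invFact i * falling r i * pow y i      ≡⟨ regroup (invFact i) (falling r i) (pow y i) ⟩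
    falling r i * expTerm y i              ∎

-- Both series are dominated by the series at 3, so past K each tail contributes at most 2 t₃(K).
∣sumℚ-sumℚ∣≤ : ∀ {m M K} (g e d : ℕ → ℚ) → 5 ℕ.≤ K → K ℕ.≤ m → K ℕ.≤ M →
  (∀ i → i ℕ.< m → ∣ g i ∣ ≤ expTerm₃ i) → (∀ i → ∣ e i ∣ ≤ expTerm₃ i) →
  (∀ i → i ℕ.< K → ∣ g i - e i ∣ ≤ d i) →
  ∣ sumℚ m g - sumℚ M e ∣ ≤ sumℚ K d + ι 4 * expTerm₃ K
∣sumℚ-sumℚ∣≤ {m} {M} {K} g e d 5≤K K≤m K≤M g≤t₃ e≤t₃ g-e≤d = begin
  ∣ sumℚ m g - sumℚ M e ∣
    ≡⟨ cong₂ (λ a b → ∣ a - b ∣) (sumℚ-split-≤ g K≤m) (sumℚ-split-≤ e K≤M) ⟩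
  ∣ (sumℚ K g + tail-g) - (sumℚ K e + tail-e) ∣
    ≡⟨ cong ∣_∣ (trans (interchange (sumℚ K g) tail-g (sumℚ K e) tail-e)
                       (cong (_+ (tail-g - tail-e)) (sym (sumℚ-distrib-- K g e)))) ⟩
  ∣ sumℚ K (λ i → g i - e i) + (tail-g - tail-e) ∣
    ≤⟨ ∣p+q∣≤∣p∣+∣q∣ (sumℚ K (λ i → g i - e i)) (tail-g - tail-e) ⟩
  ∣ sumℚ K (λ i → g i - e i) ∣ + ∣ tail-g - tail-e ∣
    ≤⟨ +-mono-≤ (∣sumℚ∣≤sumℚ K (λ i → g i - e i) d g-e≤d) (∣p-q∣≤∣p∣+∣q∣ tail-g tail-e) ⟩
  sumℚ K d + (∣ tail-g ∣ + ∣ tail-e ∣)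
    ≤⟨ +-monoʳ-≤ (sumℚ K d) (+-mono-≤ ∣tail-g∣≤ ∣tail-e∣≤) ⟩
  sumℚ K d + (ι 2 * expTerm₃ K + ι 2 * expTerm₃ K)
    ≡⟨ cong (sumℚ K d +_) (double (expTerm₃ K)) ⟩
  sumℚ K d + ι 4 * expTerm₃ K ∎
  where
  open ≤-Reasoning
  tail-g = sumℚ (m ∸ K) (λ i → g (K ℕ.+ i))
  tail-e = sumℚ (M ∸ K) (λ i → e (K ℕ.+ i))
  interchange : ∀ a b c d → (a + b) - (c + d) ≡ (a - c) + (b - d)
  interchange = solve-∀ ℚring
  double : ∀ a → ι 2 * a + ι 2 * a ≡ ι 4 * a
  double = solve-∀ ℚring
  ∣tail-g∣≤ : ∣ tail-g ∣ ≤ ι 2 * expTerm₃ K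
  ∣tail-g∣≤ = ≤-trans (∣sumℚ∣≤sumℚ (m ∸ K) (λ i → g (K ℕ.+ i)) (λ i → expTerm₃ (K ℕ.+ i))
      (λ i i<m-K → g≤t₃ (K ℕ.+ i) (subst (K ℕ.+ i ℕ.<_) (ℕP.m+[n∸m]≡n K≤m) (ℕP.+-monoʳ-< K i<m-K))))
    (expTerm₃-tail (m ∸ K) K 5≤K)
  ∣tail-e∣≤ : ∣ tail-e ∣ ≤ ι 2 * expTerm₃ K
  ∣tail-e∣≤ = ≤-trans (∣sumℚ∣≤sumℚ (M ∸ K) (λ i → e (K ℕ.+ i)) (λ i → expTerm₃ (K ℕ.+ i)) (λ i _ → e≤t₃ (K ℕ.+ i)))
    (expTerm₃-tail (M ∸ K) K 5≤K)

∣falling*expTerm∣≤ : ∀ {y r m} i → ∣ y ∣ ≤ ι 3 → 0ℚ ≤ r → r * ι m ≡ 1ℚ → i ℕ.≤ m →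
  ∣ falling r i * expTerm y i ∣ ≤ expTerm₃ i
∣falling*expTerm∣≤ i ∣y∣≤3 0≤r rm≡1 i≤m =
  ≤-trans (∣*∣-mono-≤ (∣falling∣≤1 i 0≤r (ι*r≤1 i≤m 0≤r rm≡1)) (∣expTerm∣≤ i ∣y∣≤3)) (≤-reflexive (*-identityˡ _))

∣[1+yr]ᵐ∣≤21 : ∀ {y r} m → ∣ y ∣ ≤ ι 3 → 0ℚ ≤ r → r * ι m ≡ 1ℚ → ∣ pow (1ℚ + y * r) m ∣ ≤ ι 21
∣[1+yr]ᵐ∣≤21 {y} {r} m ∣y∣≤3 0≤r rm≡1 = begin
  ∣ pow (1ℚ + y * r) m ∣                                 ≡⟨ cong ∣_∣ ([1+yr]ᵐ≡sumℚ m y rm≡1) ⟩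
  ∣ sumℚ (suc m) (λ i → falling r i * expTerm y i) ∣     ≤⟨ ∣sumℚ∣≤sumℚ (suc m) _ expTerm₃
                                                               (λ i i≤m → ∣falling*expTerm∣≤ i ∣y∣≤3 0≤r rm≡1 (ℕP.≤-pred i≤m)) ⟩
  sumℚ (suc m) expTerm₃                                  ≤⟨ sumℚ-expTerm₃≤21 (suc m) ⟩
  ι 21                                                   ∎
  where open ≤-Reasoning

∣[1+yr]ᵐ-expSum∣≤ : ∀ {y r} m K M → ∣ y ∣ ≤ ι 3 → 0ℚ ≤ r → r * ι m ≡ 1ℚ →
  5 ℕ.≤ K → K ℕ.≤ suc m → K ℕ.≤ M →
  ∣ pow (1ℚ + y * r) m - expSum M y ∣ ≤ ι (K ℕ.* K) * r * ι 21 + ι 4 * expTerm₃ K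
∣[1+yr]ᵐ-expSum∣≤ {y} {r} m K M ∣y∣≤3 0≤r rm≡1 5≤K K≤m+1 K≤M = begin
  ∣ pow (1ℚ + y * r) m - expSum M y ∣
    ≡⟨ cong (λ w → ∣ w - expSum M y ∣) ([1+yr]ᵐ≡sumℚ m y rm≡1) ⟩
  ∣ sumℚ (suc m) g - expSum M y ∣
    ≤⟨ ∣sumℚ-sumℚ∣≤ g (expTerm y) (λ i → K²r * expTerm₃ i) 5≤K K≤m+1 K≤M
         (λ i i≤m → ∣falling*expTerm∣≤ i ∣y∣≤3 0≤r rm≡1 (ℕP.≤-pred i≤m)) (λ i → ∣expTerm∣≤ i ∣y∣≤3) head ⟩
  sumℚ K (λ i → K²r * expTerm₃ i) + ι 4 * expTerm₃ K
    ≡⟨ cong (_+ ι 4 * expTerm₃ K) (*-distribˡ-sumℚ K K²r expTerm₃) ⟩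
  K²r * sumℚ K expTerm₃ + ι 4 * expTerm₃ K
    ≤⟨ +-monoˡ-≤ (ι 4 * expTerm₃ K) (*-monoˡ-≤-0≤ 0≤K²r (sumℚ-expTerm₃≤21 K)) ⟩
  K²r * ι 21 + ι 4 * expTerm₃ K ∎
  where
  open ≤-Reasoning
  g : ℕ → ℚ
  g i = falling r i * expTerm y i
  K²r = ι (K ℕ.* K) * r
  0≤K²r = 0≤* (ι-nonNeg (K ℕ.* K)) 0≤r
  factor : ∀ f b → f * b - b ≡ (f - 1ℚ) * b
  factor = solve-∀ ℚring
  head : ∀ i → i ℕ.< K → ∣ g i - expTerm y i ∣ ≤ K²r * expTerm₃ i
  head i i<K = begin
    ∣ falling r i * expTerm y i - expTerm y i ∣   ≡⟨ cong ∣_∣ (factor (falling r i) (expTerm y i)) ⟩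
    ∣ (falling r i - 1ℚ) * expTerm y i ∣          ≤⟨ ∣*∣-mono-≤ (≤-trans (∣falling-1∣≤ i 0≤r (ι*r≤1 i≤m 0≤r rm≡1)) i²r≤K²r)
                                                        (∣expTerm∣≤ i ∣y∣≤3) ⟩
    K²r * expTerm₃ i                              ∎
    where
    i≤m = ℕP.≤-pred (ℕP.≤-trans i<K K≤m+1)
    i²r≤K²r = *-monoʳ-≤-0≤ 0≤r (ι-mono-≤ (ℕP.*-mono-≤ (ℕP.<⇒≤ i<K) (ℕP.<⇒≤ i<K)))

[1+yr]ᵐ→expSum : ∀ η → 0ℚ < η →
  Eventually (λ m → ∀ r → 0ℚ ≤ r → r * ι m ≡ 1ℚ →
    Eventually (λ M → ∀ y → ∣ y ∣ ≤ ι 3 → ∣ pow (1ℚ + y * r) m - expSum M y ∣ ≤ η))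
[1+yr]ᵐ→expSum η 0<η = eventually-map approximation
  (eventually-× (eventually-≥ K) (*1/n-eventually-≤ (ι (K ℕ.* K) * ι 21) η₂ 0<η₂))
  where
  η₂ = η * 1/suc 1
  0<η₂ = 0<* 0<η (0<1/suc 1)
  chosen : ∃[ K ] (5 ℕ.≤ K × expTerm₃ K ≤ η * 1/suc 7)
  chosen = eventually-witness (eventually-× (eventually-≥ 5) (expTerm₃→0 (η * 1/suc 7) (0<* 0<η (0<1/suc 7))))
  K = proj₁ chosen
  5≤K = proj₁ (proj₂ chosen)
  4t₃≤η₂ : ι 4 * expTerm₃ K ≤ η₂
  4t₃≤η₂ = ≤-trans (*-monoˡ-≤-0≤ (ι-nonNeg 4) (proj₂ (proj₂ chosen))) (≤-reflexive (swap (ι 4) η (1/suc 7)))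
    where
    swap : ∀ a b c → a * (b * c) ≡ b * (a * c)
    swap = solve-∀ ℚring
  reorder : ∀ a r c → a * r * c ≡ a * c * r
  reorder = solve-∀ ℚring
  approximation : ∀ m → K ℕ.≤ m × (∀ r → 0ℚ ≤ r → r * ι m ≡ 1ℚ → ι (K ℕ.* K) * ι 21 * r ≤ η₂) →
    ∀ r → 0ℚ ≤ r → r * ι m ≡ 1ℚ →
    Eventually (λ M → ∀ y → ∣ y ∣ ≤ ι 3 → ∣ pow (1ℚ + y * r) m - expSum M y ∣ ≤ η)
  approximation m (K≤m , K²r-small) r 0≤r rm≡1 = K , λ M K≤M y ∣y∣≤3 → begin
    ∣ pow (1ℚ + y * r) m - expSum M y ∣
      ≤⟨ ∣[1+yr]ᵐ-expSum∣≤ m K M ∣y∣≤3 0≤r rm≡1 5≤K (ℕP.m≤n⇒m≤1+n K≤m) K≤M ⟩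
    ι (K ℕ.* K) * r * ι 21 + ι 4 * expTerm₃ K
      ≤⟨ +-mono-≤ (≤-trans (≤-reflexive (reorder (ι (K ℕ.* K)) r (ι 21))) (K²r-small r 0≤r rm≡1)) 4t₃≤η₂ ⟩
    η₂ + η₂
      ≡⟨ half+half η ⟩
    η ∎
    where open ≤-Reasoning

-- exp(-y) exp(y) = 1 for the truncated series

∣1-a*b∣≤ : ∀ {a b a′ b′ C ε η} → ∣ 1ℚ - a′ * b′ ∣ ≤ ε → ∣ a′ ∣ ≤ C → ∣ b ∣ ≤ C →
  ∣ b′ - b ∣ ≤ η → ∣ a′ - a ∣ ≤ η → ∣ 1ℚ - a * b ∣ ≤ ε + (C * η + C * η)
∣1-a*b∣≤ {a} {b} {a′} {b′} 1-a′b′≤ε ∣a′∣≤C ∣b∣≤C b′-b≤η a′-a≤η = begin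
  ∣ 1ℚ - a * b ∣                                           ≡⟨ cong ∣_∣ (perturb a b a′ b′) ⟩
  ∣ (1ℚ - a′ * b′) + (a′ * (b′ - b) + b * (a′ - a)) ∣     ≤⟨ ∣p+q∣≤∣p∣+∣q∣ (1ℚ - a′ * b′) _ ⟩
  ∣ 1ℚ - a′ * b′ ∣ + ∣ a′ * (b′ - b) + b * (a′ - a) ∣     ≤⟨ +-monoʳ-≤ ∣ 1ℚ - a′ * b′ ∣ (∣p+q∣≤∣p∣+∣q∣ (a′ * (b′ - b)) _) ⟩
  ∣ 1ℚ - a′ * b′ ∣ + (∣ a′ * (b′ - b) ∣ + ∣ b * (a′ - a) ∣)
    ≤⟨ +-mono-≤ 1-a′b′≤ε (+-mono-≤ (∣*∣-mono-≤ ∣a′∣≤C b′-b≤η) (∣*∣-mono-≤ ∣b∣≤C a′-a≤η)) ⟩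
  _                                                        ∎
  where
  open ≤-Reasoning
  perturb : ∀ a b a′ b′ → 1ℚ - a * b ≡ (1ℚ - a′ * b′) + (a′ * (b′ - b) + b * (a′ - a))
  perturb = solve-∀ ℚring

-- (1 - y r)^m (1 + y r)^m = (1 - y² r²)^m ≥ 1 - m y² r² = 1 - y² r by Bernoulli
∣1-[1-yr]ᵐ[1+yr]ᵐ∣≤ : ∀ {y r} m → ∣ y ∣ ≤ ι 3 → 0ℚ ≤ r → r * ι m ≡ 1ℚ → 3 ℕ.≤ m →
  ∣ 1ℚ - pow (1ℚ + (- y) * r) m * pow (1ℚ + y * r) m ∣ ≤ ι 3 * ι 3 * r
∣1-[1-yr]ᵐ[1+yr]ᵐ∣≤ {y} {r} m ∣y∣≤3 0≤r rm≡1 3≤m = begin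
  ∣ 1ℚ - pow (1ℚ + (- y) * r) m * pow (1ℚ + y * r) m ∣   ≡⟨ cong (λ w → ∣ 1ℚ - w ∣) product ⟩
  ∣ 1ℚ - pow (1ℚ - c) m ∣                                 ≡⟨ 0≤p⇒∣p∣≡p (p≤q⇒0≤q-p (pow-≤1 m (p≤q⇒0≤q-p c≤1) (0≤p⇒1-p≤1 0≤c))) ⟩
  1ℚ - pow (1ℚ - c) m                                     ≤⟨ +-monoʳ-≤ 1ℚ (neg-antimono-≤ (bernoulli m 0≤c c≤1)) ⟩
  1ℚ - (1ℚ - ι m * c)                                     ≡⟨ cancel (ι m) ∣y∣ r ⟩
  ∣y∣ * ∣y∣ * r * (r * ι m)                               ≡⟨ trans (cong (∣y∣ * ∣y∣ * r *_) rm≡1) (*-identityʳ _) ⟩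
  ∣y∣ * ∣y∣ * r                                           ≤⟨ *-monoʳ-≤-0≤ 0≤r y²≤9 ⟩
  ι 3 * ι 3 * r                                           ∎
  where
  open ≤-Reasoning
  ∣y∣ = ∣ y ∣
  c = ∣y∣ * ∣y∣ * (r * r)
  0≤c = 0≤* (0≤* (0≤∣p∣ y) (0≤∣p∣ y)) (0≤* 0≤r 0≤r)
  y²≤9 = *-mono-≤-0≤ (0≤∣p∣ y) (0≤∣p∣ y) ∣y∣≤3 ∣y∣≤3
  3r≤1 = ι*r≤1 {3} {m} 3≤m 0≤r rm≡1
  0≤3r = 0≤* (ι-nonNeg 3) 0≤r
  regroup : ∀ t r → t * t * (r * r) ≡ (t * r) * (t * r)
  regroup = solve-∀ ℚring
  c≤1 : c ≤ 1ℚ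
  c≤1 = begin
    ∣y∣ * ∣y∣ * (r * r)       ≤⟨ *-monoʳ-≤-0≤ (0≤* 0≤r 0≤r) y²≤9 ⟩
    ι 3 * ι 3 * (r * r)       ≡⟨ regroup (ι 3) r ⟩
    (ι 3 * r) * (ι 3 * r)     ≤⟨ *-mono-≤-0≤ 0≤3r 0≤3r 3r≤1 3r≤1 ⟩
    1ℚ * 1ℚ                   ≡⟨ *-identityˡ 1ℚ ⟩
    1ℚ                        ∎
  conjugate : ∀ y r → (1ℚ + (- y) * r) * (1ℚ + y * r) ≡ 1ℚ - y * y * (r * r)
  conjugate = solve-∀ ℚring
  product : pow (1ℚ + (- y) * r) m * pow (1ℚ + y * r) m ≡ pow (1ℚ - c) m
  product = trans (sym (pow-distribʳ-* (1ℚ + (- y) * r) (1ℚ + y * r) m))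
    (cong (λ w → pow w m) (trans (conjugate y r) (cong (λ w → 1ℚ - w * (r * r)) (p*p≡∣p∣*∣p∣ y))))
  cancel : ∀ M a r → 1ℚ - (1ℚ - M * (a * a * (r * r))) ≡ a * a * r * (r * M)
  cancel = solve-∀ ℚring

expSum-neg*expSum→1 : ∀ δ → 0ℚ < δ →
  Eventually (λ M → ∀ y → ∣ y ∣ ≤ ι 3 → ∣ 1ℚ - expSum M (- y) * expSum M y ∣ ≤ δ)
expSum-neg*expSum→1 δ 0<δ = eventually-map bound (approx r (0≤1/suc n) (1/suc-inverse n))
  where
  δ₂ = δ * 1/suc 1
  0<δ₂ = 0<* 0<δ (0<1/suc 1)
  η = δ₂ * 1/suc 41
  chosen : ∃[ n ] ((∀ r → 0ℚ ≤ r → r * ι (suc n) ≡ 1ℚ →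
               Eventually (λ M → ∀ y → ∣ y ∣ ≤ ι 3 → ∣ pow (1ℚ + y * r) (suc n) - expSum M y ∣ ≤ η)) ×
             3 ℕ.≤ suc n × (∀ r → 0ℚ ≤ r → r * ι (suc n) ≡ 1ℚ → ι 3 * ι 3 * r ≤ δ₂))
  chosen = eventually-suc (eventually-× ([1+yr]ᵐ→expSum η (0<* 0<δ₂ (0<1/suc 41)))
                          (eventually-× (eventually-≥ 3) (*1/n-eventually-≤ (ι 3 * ι 3) δ₂ 0<δ₂)))
  n = proj₁ chosen
  approx = proj₁ (proj₂ chosen)
  3≤m = proj₁ (proj₂ (proj₂ chosen))
  9r≤δ₂ = proj₂ (proj₂ (proj₂ chosen))
  r = 1/suc n
  rm≡1 = 1/suc-inverse n
  0≤r = 0≤1/suc n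
  collect : ∀ c η → c * η + c * η ≡ (c + c) * η
  collect = solve-∀ ℚring
  total : δ₂ + (ι 21 * η + ι 21 * η) ≡ δ
  total = trans (cong (δ₂ +_) (trans (collect (ι 21) η) (*-1/suc δ₂ 41))) (half+half δ)
  bound : ∀ M → (∀ y → ∣ y ∣ ≤ ι 3 → ∣ pow (1ℚ + y * r) (suc n) - expSum M y ∣ ≤ η) →
    ∀ y → ∣ y ∣ ≤ ι 3 → ∣ 1ℚ - expSum M (- y) * expSum M y ∣ ≤ δ
  bound M close y ∣y∣≤3 = ≤-trans
    (∣1-a*b∣≤ (≤-trans (∣1-[1-yr]ᵐ[1+yr]ᵐ∣≤ (suc n) ∣y∣≤3 0≤r rm≡1 3≤m) (9r≤δ₂ r 0≤r rm≡1))
      (∣[1+yr]ᵐ∣≤21 (suc n) ∣-y∣≤3 0≤r rm≡1) (∣expSum∣≤21 M ∣y∣≤3) (close y ∣y∣≤3) (close (- y) ∣-y∣≤3))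
    (≤-reflexive total)
    where
    ∣-y∣≤3 = subst (_≤ ι 3) (sym (∣-p∣≡∣p∣ y)) ∣y∣≤3

-- Normalised subtree counts

-- With n = k + 2 and r = 1/n, subtreeTerm r k j = r^(n-2) a_(n-1-j): the subtrees missing exactly j vertices.
subtreeTerm : ℚ → ℕ → ℕ → ℚ
subtreeTerm r k j = invFact j * falling r j * pow (1ℚ - ι j * r) (k ∸ j)

subtreeSum : ℚ → ℕ → (ℕ → ℚ) → ℚ
subtreeSum r k w = sumℚ (suc k) (λ j → w j * subtreeTerm r k j)

-- The weight 1 gives p_n; the weight 1 - j/(n-1), the relative edge count of a tree missing j vertices, gives q_n.
AdmissibleWeight : (ℕ → ℚ) → ℚ → Set
AdmissibleWeight w r = ∀ j → (0ℚ ≤ w j) × (w j ≤ 1ℚ) × (∣ 1ℚ - w j ∣ ≤ ι j * (ι 2 * r))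

subtreeTerm-bounds : ∀ {r} k j → 0ℚ ≤ r → r * ι (suc (suc k)) ≡ 1ℚ → j ℕ.≤ k →
  (0ℚ ≤ subtreeTerm r k j) × (subtreeTerm r k j ≤ invFact j)
subtreeTerm-bounds {r} k j 0≤r rn≡1 j≤k =
  0≤* 0≤jf (pow-nonNeg (k ∸ j) 0≤1-jr) ,
  ≤-trans (*-mono-≤-0≤ 0≤jf (pow-nonNeg (k ∸ j) 0≤1-jr) jf≤j (pow-≤1 (k ∸ j) 0≤1-jr (0≤p⇒1-p≤1 (0≤* (ι-nonNeg j) 0≤r))))
    (≤-reflexive (*-identityʳ (invFact j)))
  where
  jr≤1 = ι*r≤1 (ℕP.≤-trans j≤k (ℕP.≤-trans (ℕP.n≤1+n k) (ℕP.n≤1+n (suc k)))) 0≤r rn≡1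
  bounds = falling-bounds j 0≤r jr≤1
  0≤1-jr = p≤q⇒0≤q-p jr≤1
  0≤jf = 0≤* (invFact-nonNeg j) (proj₁ bounds)
  jf≤j = ≤-trans (*-monoˡ-≤-0≤ (invFact-nonNeg j) (proj₁ (proj₂ bounds))) (≤-reflexive (*-identityʳ (invFact j)))

-- |aⁿ - bⁿ| ≤ n |a - b| on [0, 1], and n r² = r
∣[1-jr]ⁿ-[1-r]ʲⁿ∣≤ : ∀ {r} n j → 0ℚ ≤ r → r ≤ 1ℚ → r * ι n ≡ 1ℚ → ι j * r ≤ 1ℚ →
  ∣ pow (1ℚ - ι j * r) n - pow (pow (1ℚ - r) j) n ∣ ≤ ι (j ℕ.* j) * r
∣[1-jr]ⁿ-[1-r]ʲⁿ∣≤ {r} n j 0≤r r≤1 rn≡1 jr≤1 = begin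
  ∣ pow (1ℚ - ι j * r) n - pow (pow (1ℚ - r) j) n ∣
    ≤⟨ ∣pow-pow∣≤ n (∣p∣≤1⇐0≤p≤1 (p≤q⇒0≤q-p jr≤1) (0≤p⇒1-p≤1 (0≤* (ι-nonNeg j) 0≤r)))
         (∣p∣≤1⇐0≤p≤1 (pow-nonNeg j 0≤1-r) (pow-≤1 j 0≤1-r (0≤p⇒1-p≤1 0≤r))) ≤-refl ⟩
  ι n * pow 1ℚ n * ∣ (1ℚ - ι j * r) - pow (1ℚ - r) j ∣
    ≤⟨ *-monoˡ-≤-0≤ (0≤* (ι-nonNeg n) (pow-nonNeg n 0≤1)) (∣1-jr-pow∣≤ j 0≤r r≤1) ⟩
  ι n * pow 1ℚ n * (ι (j ℕ.* j) * (r * r))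
    ≡⟨ cong (λ w → ι n * w * (ι (j ℕ.* j) * (r * r))) (pow-1ℚ n) ⟩
  ι n * 1ℚ * (ι (j ℕ.* j) * (r * r))
    ≡⟨ regroup (ι n) (ι (j ℕ.* j)) r ⟩
  ι (j ℕ.* j) * r * (r * ι n)
    ≡⟨ trans (cong (ι (j ℕ.* j) * r *_) rn≡1) (*-identityʳ _) ⟩
  ι (j ℕ.* j) * r ∎
  where
  open ≤-Reasoning
  0≤1-r = p≤q⇒0≤q-p r≤1
  regroup : ∀ N J r → N * 1ℚ * (J * (r * r)) ≡ J * r * (r * N)
  regroup = solve-∀ ℚring

∣subtreeTerm-expTerm∣≤ : ∀ {r x} K k j → 0ℚ ≤ r → r * ι (suc (suc k)) ≡ 1ℚ → j ℕ.< K → j ℕ.≤ k → ∣ x ∣ ≤ ι 3 →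
  ∣ subtreeTerm r k j - expTerm x j ∣ ≤
    ι (K ℕ.* K) * r + ι ((K ℕ.+ 2) ℕ.* K) * r + ι (K ℕ.* K) * r
      + ι K * pow (ι 3) K * ∣ pow (1ℚ - r) (suc (suc k)) - x ∣
∣subtreeTerm-expTerm∣≤ {r} {x} K k j 0≤r rn≡1 j<K j≤k ∣x∣≤3 = begin
  ∣ invFact j * f * A - pow x j * invFact j ∣
    ≡⟨ cong ∣_∣ (factor (invFact j) f A (pow x j)) ⟩
  ∣ invFact j * (f * A - pow x j) ∣
    ≤⟨ ∣*∣-mono-≤ (∣p∣≤1⇐0≤p≤1 (invFact-nonNeg j) (invFact-≤1 j)) ≤-refl ⟩
  1ℚ * ∣ f * A - pow x j ∣
    ≡⟨ trans (*-identityˡ _) (cong ∣_∣ (telescope f A aⁿ bⁿ (pow x j))) ⟩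
  ∣ (f - 1ℚ) * A + (A - aⁿ) + (aⁿ - bⁿ) + (bⁿ - pow x j) ∣
    ≤⟨ ∣+₄∣≤ ((f - 1ℚ) * A) (A - aⁿ) (aⁿ - bⁿ) (bⁿ - pow x j) ⟩
  ∣ (f - 1ℚ) * A ∣ + ∣ A - aⁿ ∣ + ∣ aⁿ - bⁿ ∣ + ∣ bⁿ - pow x j ∣
    ≤⟨ +-mono-≤ (+-mono-≤ (+-mono-≤ falling≈1 drop-exponent) linearise) compound≈x ⟩
  ι (K ℕ.* K) * r + ι ((K ℕ.+ 2) ℕ.* K) * r + ι (K ℕ.* K) * r + ι K * pow (ι 3) K * ∣ u - x ∣ ∎
  where
  open ≤-Reasoning
  n = suc (suc k)
  f = falling r j
  A = pow (1ℚ - ι j * r) (k ∸ j)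
  aⁿ = pow (1ℚ - ι j * r) n
  bⁿ = pow (pow (1ℚ - r) j) n
  u = pow (1ℚ - r) n
  factor : ∀ F f A P → F * f * A - P * F ≡ F * (f * A - P)
  factor = solve-∀ ℚring
  telescope : ∀ f A a b P → f * A - P ≡ (f - 1ℚ) * A + (A - a) + (a - b) + (b - P)
  telescope = solve-∀ ℚring
  ∣+₄∣≤ : ∀ p q s t → ∣ p + q + s + t ∣ ≤ ∣ p ∣ + ∣ q ∣ + ∣ s ∣ + ∣ t ∣
  ∣+₄∣≤ p q s t = ≤-trans (∣p+q∣≤∣p∣+∣q∣ (p + q + s) t) (+-monoˡ-≤ ∣ t ∣
    (≤-trans (∣p+q∣≤∣p∣+∣q∣ (p + q) s) (+-monoˡ-≤ ∣ s ∣ (∣p+q∣≤∣p∣+∣q∣ p q))))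
  j≤K = ℕP.<⇒≤ j<K
  j≤n = ℕP.≤-trans j≤k (ℕP.≤-trans (ℕP.n≤1+n k) (ℕP.n≤1+n (suc k)))
  jr≤1 = ι*r≤1 j≤n 0≤r rn≡1
  0≤jr = 0≤* (ι-nonNeg j) 0≤r
  r≤1 = subst (_≤ 1ℚ) (*-identityˡ r) (ι*r≤1 {1} {n} (s≤s z≤n) 0≤r rn≡1)
  0≤1-jr = p≤q⇒0≤q-p jr≤1
  0≤1-r = p≤q⇒0≤q-p r≤1
  j²≤K² = ι-mono-≤ (ℕP.*-mono-≤ j≤K j≤K)
  falling≈1 : ∣ (f - 1ℚ) * A ∣ ≤ ι (K ℕ.* K) * r
  falling≈1 = ≤-trans (∣*∣-mono-≤ (∣falling-1∣≤ j 0≤r jr≤1)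
                        (∣p∣≤1⇐0≤p≤1 (pow-nonNeg (k ∸ j) 0≤1-jr) (pow-≤1 (k ∸ j) 0≤1-jr (0≤p⇒1-p≤1 0≤jr))))
    (≤-trans (≤-reflexive (*-identityʳ _)) (*-monoʳ-≤-0≤ 0≤r j²≤K²))
  drop-exponent : ∣ A - aⁿ ∣ ≤ ι ((K ℕ.+ 2) ℕ.* K) * r
  drop-exponent = begin
    ∣ A - aⁿ ∣                              ≡⟨ cong (λ e → ∣ A - pow (1ℚ - ι j * r) e ∣) (sym [k-j]+[j+2]≡n) ⟩
    ∣ A - pow (1ℚ - ι j * r) ((k ∸ j) ℕ.+ (j ℕ.+ 2)) ∣
                                            ≤⟨ ∣pow-pow-+∣≤ (k ∸ j) (j ℕ.+ 2) 0≤jr jr≤1 ⟩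
    ι (j ℕ.+ 2) * (ι j * r)                 ≡⟨ trans (sym (*-assoc (ι (j ℕ.+ 2)) (ι j) r)) (cong (_* r) (sym (ι-homo-* (j ℕ.+ 2) j))) ⟩
    ι ((j ℕ.+ 2) ℕ.* j) * r                 ≤⟨ *-monoʳ-≤-0≤ 0≤r (ι-mono-≤ (ℕP.*-mono-≤ (ℕP.+-monoˡ-≤ 2 j≤K) j≤K)) ⟩
    ι ((K ℕ.+ 2) ℕ.* K) * r                 ∎
    where
    [k-j]+[j+2]≡n : (k ∸ j) ℕ.+ (j ℕ.+ 2) ≡ n
    [k-j]+[j+2]≡n = trans (sym (ℕP.+-assoc (k ∸ j) j 2)) (trans (cong (ℕ._+ 2) (ℕP.m∸n+n≡m j≤k)) (ℕP.+-comm k 2))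
  linearise : ∣ aⁿ - bⁿ ∣ ≤ ι (K ℕ.* K) * r
  linearise = ≤-trans (∣[1-jr]ⁿ-[1-r]ʲⁿ∣≤ n j 0≤r r≤1 rn≡1 jr≤1) (*-monoʳ-≤-0≤ 0≤r j²≤K²)
  1≤3 : 1ℚ ≤ ι 3
  1≤3 = ι-mono-≤ {1} {3} (s≤s z≤n)
  compound≈x : ∣ bⁿ - pow x j ∣ ≤ ι K * pow (ι 3) K * ∣ u - x ∣
  compound≈x = begin
    ∣ bⁿ - pow x j ∣            ≡⟨ cong (λ w → ∣ w - pow x j ∣) (trans (pow-*-assoc (1ℚ - r) j n)
                                     (trans (cong (pow (1ℚ - r)) (ℕP.*-comm j n)) (sym (pow-*-assoc (1ℚ - r) n j)))) ⟩
    ∣ pow u j - pow x j ∣       ≤⟨ ∣pow-pow∣≤ j (≤-trans (∣p∣≤1⇐0≤p≤1 (pow-nonNeg n 0≤1-r) (pow-≤1 n 0≤1-r (0≤p⇒1-p≤1 0≤r))) 1≤3) ∣x∣≤3 1≤3 ⟩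
    ι j * pow (ι 3) j * ∣ u - x ∣
                                ≤⟨ *-monoʳ-≤-0≤ (0≤∣p∣ (u - x)) (*-mono-≤-0≤ (ι-nonNeg j) (pow-nonNeg j (ι-nonNeg 3))
                                     (ι-mono-≤ j≤K) (pow-monoʳ-≤ j K 1≤3 j≤K)) ⟩
    ι K * pow (ι 3) K * ∣ u - x ∣ ∎

coeffʳ coeffˣ : ℕ → ℚ
coeffʳ K = ι K * (ι K * ι 2 + ι (K ℕ.* K) + ι ((K ℕ.+ 2) ℕ.* K) + ι (K ℕ.* K))
coeffˣ K = ι K * (ι K * pow (ι 3) K)

∣subtreeSum-expSum∣≤ : ∀ {r x} k (w : ℕ → ℚ) K M → 0ℚ ≤ r → r * ι (suc (suc k)) ≡ 1ℚ → AdmissibleWeight w r →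
  5 ℕ.≤ K → K ℕ.≤ suc k → K ℕ.≤ M → ∣ x ∣ ≤ ι 3 →
  ∣ subtreeSum r k w - expSum M x ∣ ≤ coeffʳ K * r + coeffˣ K * ∣ pow (1ℚ - r) (suc (suc k)) - x ∣ + ι 4 * expTerm₃ K
∣subtreeSum-expSum∣≤ {r} {x} k w K M 0≤r rn≡1 admissible 5≤K K≤k+1 K≤M ∣x∣≤3 = begin
  ∣ subtreeSum r k w - expSum M x ∣
    ≤⟨ ∣sumℚ-sumℚ∣≤ g (expTerm x) (λ _ → Q) 5≤K K≤k+1 K≤M g≤t₃ (λ i → ∣expTerm∣≤ i ∣x∣≤3) head ⟩
  sumℚ K (λ _ → Q) + ι 4 * expTerm₃ K
    ≡⟨ cong (_+ ι 4 * expTerm₃ K) (trans (sumℚ-const K Q)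
         (regroup (ι K) (ι 2) (ι (K ℕ.* K)) (ι ((K ℕ.+ 2) ℕ.* K)) (pow (ι 3) K) r d)) ⟩
  coeffʳ K * r + coeffˣ K * d + ι 4 * expTerm₃ K ∎
  where
  open ≤-Reasoning
  d = ∣ pow (1ℚ - r) (suc (suc k)) - x ∣
  Q = ι K * (ι 2 * r) + (ι (K ℕ.* K) * r + ι ((K ℕ.+ 2) ℕ.* K) * r + ι (K ℕ.* K) * r + ι K * pow (ι 3) K * d)
  g : ℕ → ℚ
  g j = w j * subtreeTerm r k j
  regroup : ∀ k t a b p r d → k * (k * (t * r) + (a * r + b * r + a * r + k * p * d)) ≡
                               k * (k * t + a + b + a) * r + k * (k * p) * d
  regroup = solve-∀ ℚring
  0≤w : ∀ j → 0ℚ ≤ w j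
  0≤w j = proj₁ (admissible j)
  w≤1 : ∀ j → w j ≤ 1ℚ
  w≤1 j = proj₁ (proj₂ (admissible j))
  w≈1 : ∀ j → ∣ 1ℚ - w j ∣ ≤ ι j * (ι 2 * r)
  w≈1 j = proj₂ (proj₂ (admissible j))
  g≤t₃ : ∀ j → j ℕ.< suc k → ∣ g j ∣ ≤ expTerm₃ j
  g≤t₃ j j≤k = ≤-trans (∣*∣-mono-≤ (∣p∣≤1⇐0≤p≤1 (0≤w j) (w≤1 j))
      (subst (_≤ invFact j) (sym (0≤p⇒∣p∣≡p (proj₁ bounds))) (proj₂ bounds)))
    (≤-trans (≤-reflexive (*-identityˡ (invFact j)))
      (subst (_≤ expTerm₃ j) (*-identityˡ (invFact j)) (*-monoʳ-≤-0≤ (invFact-nonNeg j) (1≤pow j (ι-mono-≤ {1} {3} (s≤s z≤n))))))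
    where bounds = subtreeTerm-bounds k j 0≤r rn≡1 (ℕP.≤-pred j≤k)
  split : ∀ w t e → w * t - e ≡ (w - 1ℚ) * t + (t - e)
  split = solve-∀ ℚring
  head : ∀ j → j ℕ.< K → ∣ g j - expTerm x j ∣ ≤ Q
  head j j<K = begin
    ∣ w j * subtreeTerm r k j - expTerm x j ∣
      ≡⟨ cong ∣_∣ (split (w j) (subtreeTerm r k j) (expTerm x j)) ⟩
    ∣ (w j - 1ℚ) * subtreeTerm r k j + (subtreeTerm r k j - expTerm x j) ∣
      ≤⟨ ∣p+q∣≤∣p∣+∣q∣ ((w j - 1ℚ) * subtreeTerm r k j) (subtreeTerm r k j - expTerm x j) ⟩
    ∣ (w j - 1ℚ) * subtreeTerm r k j ∣ + ∣ subtreeTerm r k j - expTerm x j ∣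
      ≤⟨ +-mono-≤ weight-error (∣subtreeTerm-expTerm∣≤ K k j 0≤r rn≡1 j<K j≤k ∣x∣≤3) ⟩
    Q ∎
    where
    j≤k = ℕP.≤-pred (ℕP.≤-trans j<K K≤k+1)
    bounds = subtreeTerm-bounds k j 0≤r rn≡1 j≤k
    weight-error : ∣ (w j - 1ℚ) * subtreeTerm r k j ∣ ≤ ι K * (ι 2 * r)
    weight-error = ≤-trans
      (∣*∣-mono-≤ (subst (_≤ ι j * (ι 2 * r)) (∣p-q∣≡∣q-p∣ 1ℚ (w j)) (w≈1 j))
                  (∣p∣≤1⇐0≤p≤1 (proj₁ bounds) (≤-trans (proj₂ bounds) (invFact-≤1 j))))
      (≤-trans (≤-reflexive (*-identityʳ _)) (*-monoʳ-≤-0≤ (0≤* (ι-nonNeg 2) 0≤r) (ι-mono-≤ (ℕP.<⇒≤ j<K))))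

subtreeSum→expSum : ∀ δ → 0ℚ < δ →
  Eventually (λ k → ∀ r → 0ℚ ≤ r → r * ι (suc (suc k)) ≡ 1ℚ → ∀ w → AdmissibleWeight w r →
    Eventually (λ M → ∣ subtreeSum r k w - expSum M (xTrunc M) ∣ ≤ δ))
subtreeSum→expSum δ 0<δ = eventually-map bound
  (eventually-+ 2 (eventually-× (eventually-≥ (suc K)) (eventually-× rate-small compound-close)))
  where
  δ₃ = δ * 1/suc 2
  0<δ₃ = 0<* 0<δ (0<1/suc 2)
  chosen : ∃[ K ] (5 ℕ.≤ K × expTerm₃ K ≤ δ₃ * 1/suc 3)
  chosen = eventually-witness (eventually-× (eventually-≥ 5) (expTerm₃→0 (δ₃ * 1/suc 3) (0<* 0<δ₃ (0<1/suc 3))))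
  K = proj₁ chosen
  5≤K = proj₁ (proj₂ chosen)
  swap : ∀ a b c → a * (b * c) ≡ b * (a * c)
  swap = solve-∀ ℚring
  4t₃≤δ₃ : ι 4 * expTerm₃ K ≤ δ₃
  4t₃≤δ₃ = ≤-trans (*-monoˡ-≤-0≤ (ι-nonNeg 4) (proj₂ (proj₂ chosen)))
    (≤-reflexive (trans (swap (ι 4) δ₃ (1/suc 3)) (*-identityʳ δ₃)))
  N : ℕ
  N = proj₁ (archimedean (coeffˣ K))
  coeffˣ≤N+1 : coeffˣ K ≤ ι (suc N)
  coeffˣ≤N+1 = ≤-trans (proj₂ (archimedean (coeffˣ K))) (ι-mono-≤ (ℕP.n≤1+n N))
  η = δ₃ * 1/suc N
  rate-small : Eventually (λ n → ∀ r → 0ℚ ≤ r → r * ι n ≡ 1ℚ → coeffʳ K * r ≤ δ₃)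
  rate-small = *1/n-eventually-≤ (coeffʳ K) δ₃ 0<δ₃
  compound-close : Eventually (λ n → ∀ r → 0ℚ ≤ r → r * ι n ≡ 1ℚ →
    Eventually (λ M → ∀ y → ∣ y ∣ ≤ ι 3 → ∣ pow (1ℚ + y * r) n - expSum M y ∣ ≤ η))
  compound-close = [1+yr]ᵐ→expSum η (0<* 0<δ₃ (0<1/suc N))
  thirds : δ₃ + δ₃ + δ₃ ≡ δ
  thirds = trans (collect δ (1/suc 2)) (*-identityʳ δ)
    where
    collect : ∀ δ t → δ * t + δ * t + δ * t ≡ δ * (t + t + t)
    collect = solve-∀ ℚring
  1-r≡1+[-1]r : ∀ r → 1ℚ - r ≡ 1ℚ + (- 1ℚ) * r
  1-r≡1+[-1]r = solve-∀ ℚring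
  bound : ∀ k → suc K ℕ.≤ suc (suc k) ×
      (∀ r → 0ℚ ≤ r → r * ι (suc (suc k)) ≡ 1ℚ → coeffʳ K * r ≤ δ₃) ×
      (∀ r → 0ℚ ≤ r → r * ι (suc (suc k)) ≡ 1ℚ →
        Eventually (λ M → ∀ y → ∣ y ∣ ≤ ι 3 → ∣ pow (1ℚ + y * r) (suc (suc k)) - expSum M y ∣ ≤ η)) →
    ∀ r → 0ℚ ≤ r → r * ι (suc (suc k)) ≡ 1ℚ → ∀ w → AdmissibleWeight w r →
    Eventually (λ M → ∣ subtreeSum r k w - expSum M (xTrunc M) ∣ ≤ δ)
  bound k (K<k+2 , coeffʳr≤ , close) r 0≤r rn≡1 w admissible =
    eventually-map final (eventually-× (eventually-≥ K) (close r 0≤r rn≡1))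
    where
    open ≤-Reasoning
    final : ∀ M → K ℕ.≤ M × (∀ y → ∣ y ∣ ≤ ι 3 → ∣ pow (1ℚ + y * r) (suc (suc k)) - expSum M y ∣ ≤ η) →
      ∣ subtreeSum r k w - expSum M (xTrunc M) ∣ ≤ δ
    final M (K≤M , close-at) = begin
      ∣ subtreeSum r k w - expSum M (xTrunc M) ∣
        ≤⟨ ∣subtreeSum-expSum∣≤ k w K M 0≤r rn≡1 admissible 5≤K (ℕP.≤-pred K<k+2) K≤M (∣xTrunc∣≤3 M) ⟩
      coeffʳ K * r + coeffˣ K * d + ι 4 * expTerm₃ K
        ≤⟨ +-mono-≤ (+-mono-≤ (coeffʳr≤ r 0≤r rn≡1) coeffˣd≤δ₃) 4t₃≤δ₃ ⟩
      δ₃ + δ₃ + δ₃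
        ≡⟨ thirds ⟩
      δ ∎
      where
      d = ∣ pow (1ℚ - r) (suc (suc k)) - xTrunc M ∣
      d≤η : d ≤ η
      d≤η = subst (λ z → ∣ pow z (suc (suc k)) - xTrunc M ∣ ≤ η) (sym (1-r≡1+[-1]r r)) (close-at (- 1ℚ) (≤ᵇ⇒≤ _))
      coeffˣd≤δ₃ : coeffˣ K * d ≤ δ₃
      coeffˣd≤δ₃ = ≤-trans (*-mono-≤-0≤ (0≤* (ι-nonNeg K) (0≤* (ι-nonNeg K) (pow-nonNeg K (ι-nonNeg 3)))) (0≤∣p∣ _) coeffˣ≤N+1 d≤η)
        (≤-reflexive (*-1/suc δ₃ N))

ι-sumFrom : ∀ lo len (f : ℕ → ℕ) → ι (sumFrom lo len f) ≡ sumℚ len (λ i → ι (f (lo ℕ.+ i)))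
ι-sumFrom lo zero      f = refl
ι-sumFrom lo (suc len) f = begin
  ι (f lo ℕ.+ sumFrom (suc lo) len f)
    ≡⟨ ι-homo-+ (f lo) (sumFrom (suc lo) len f) ⟩
  ι (f lo) + ι (sumFrom (suc lo) len f)
    ≡⟨ cong₂ _+_ (cong (ι ∘ f) (sym (ℕP.+-identityʳ lo)))
         (trans (ι-sumFrom (suc lo) len f) (sumℚ-cong len (λ i _ → cong (ι ∘ f) (sym (ℕP.+-suc lo i))))) ⟩
  ι (f (lo ℕ.+ 0)) + sumℚ len (λ i → ι (f (lo ℕ.+ suc i)))
    ≡⟨ sym (sumℚ-shift len (λ i → ι (f (lo ℕ.+ i)))) ⟩
  sumℚ (suc len) (λ i → ι (f (lo ℕ.+ i))) ∎
  where open ≡-Reasoning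

ι-a*rᵏ≡subtreeTerm : ∀ {r} k j → r * ι (suc (suc k)) ≡ 1ℚ → j ℕ.≤ k →
  ι (a (suc (suc k)) (suc (k ∸ j))) * pow r k ≡ subtreeTerm r k j
ι-a*rᵏ≡subtreeTerm {r} k j rn≡1 j≤k = begin
  ι ((n C suc (suc e)) ℕ.* (suc (suc e) ℕ.^ e)) * pow r k
    ≡⟨ cong (λ z → ι ((n C z) ℕ.* (z ℕ.^ e)) * pow r k) 2+e≡n-j ⟩
  ι ((n C (n ∸ j)) ℕ.* ((n ∸ j) ℕ.^ e)) * pow r k
    ≡⟨ cong (λ u → ι (u ℕ.* ((n ∸ j) ℕ.^ e)) * pow r k) (sym (nCk≡nC[n∸k] j≤n)) ⟩
  ι ((n C j) ℕ.* ((n ∸ j) ℕ.^ e)) * pow r k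
    ≡⟨ cong₂ _*_ (trans (ι-homo-* (n C j) ((n ∸ j) ℕ.^ e)) (cong (ι (n C j) *_) (ι-homo-^ (n ∸ j) e)))
                 (trans (cong (pow r) (sym (ℕP.m+[n∸m]≡n j≤k))) (pow-distribˡ-+-* r j e)) ⟩
  ι (n C j) * pow (ι (n ∸ j)) e * (pow r j * pow r e)
    ≡⟨ interchange (ι (n C j)) (pow (ι (n ∸ j)) e) (pow r j) (pow r e) ⟩
  ι (n C j) * pow r j * (pow (ι (n ∸ j)) e * pow r e)
    ≡⟨ cong₂ _*_ (ι-C*pow≡invFact*falling j rn≡1 j≤n) (sym (pow-distribʳ-* (ι (n ∸ j)) r e)) ⟩
  invFact j * falling r j * pow (ι (n ∸ j) * r) e
    ≡⟨ cong (λ w → invFact j * falling r j * pow w e) (ι[m∸i]*r≡1-ι[i]*r j≤n rn≡1) ⟩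
  invFact j * falling r j * pow (1ℚ - ι j * r) e ∎
  where
  open ≡-Reasoning
  n = suc (suc k)
  e = k ∸ j
  j≤n = ℕP.≤-trans j≤k (ℕP.≤-trans (ℕP.n≤1+n k) (ℕP.n≤1+n (suc k)))
  2+e≡n-j : suc (suc e) ≡ n ∸ j
  2+e≡n-j = sym (ℕP.+-∸-assoc 2 j≤k)
  interchange : ∀ c q a b → c * q * (a * b) ≡ c * a * (q * b)
  interchange = solve-∀ ℚring

-- Reversing the sum puts the spanning trees (k + 1 edges) first, at j = 0.
ι-sumFrom-a-reversed : ∀ k (f : ℕ → ℕ) →
  ι (sumFrom 1 (suc k) f) ≡ sumℚ (suc k) (λ j → ι (f (suc (k ∸ j))))
ι-sumFrom-a-reversed k f = trans (ι-sumFrom 1 (suc k) f) (sumℚ-reverse (suc k) (λ i → ι (f (suc i))))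

ι-totA*rᵏ≡subtreeSum : ∀ {r} k → r * ι (suc (suc k)) ≡ 1ℚ →
  ι (totA (suc (suc k))) * pow r k ≡ subtreeSum r k (λ _ → 1ℚ)
ι-totA*rᵏ≡subtreeSum {r} k rn≡1 = begin
  ι (totA n) * pow r k
    ≡⟨ trans (cong (_* pow r k) (ι-sumFrom-a-reversed k (a n))) (*-comm _ (pow r k)) ⟩
  pow r k * sumℚ (suc k) (λ j → ι (a n (suc (k ∸ j))))
    ≡⟨ sym (*-distribˡ-sumℚ (suc k) (pow r k) (λ j → ι (a n (suc (k ∸ j))))) ⟩
  sumℚ (suc k) (λ j → pow r k * ι (a n (suc (k ∸ j))))
    ≡⟨ sumℚ-cong (suc k) (λ j j≤k → trans (*-comm (pow r k) _)
         (trans (ι-a*rᵏ≡subtreeTerm k j rn≡1 (ℕP.≤-pred j≤k)) (sym (*-identityˡ _)))) ⟩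
  subtreeSum r k (λ _ → 1ℚ) ∎
  where
  open ≡-Reasoning
  n = suc (suc k)

-- 1 - j/(k+1), capped at j = k so that it is admissible for every j
edgeWeight : ℕ → ℚ → ℕ → ℚ
edgeWeight k s j = 1ℚ - ι (j ℕ.⊓ k) * s

edgeWeight-0 : ∀ k s → edgeWeight k s 0 ≡ 1ℚ
edgeWeight-0 k s = drop s
  where
  drop : ∀ s → 1ℚ - 0ℚ * s ≡ 1ℚ
  drop = solve-∀ ℚring

ι-totKA*rᵏs≡subtreeSum : ∀ {r s} k → r * ι (suc (suc k)) ≡ 1ℚ → s * ι (suc k) ≡ 1ℚ →
  ι (totKA (suc (suc k))) * (pow r k * s) ≡ subtreeSum r k (edgeWeight k s)
ι-totKA*rᵏs≡subtreeSum {r} {s} k rn≡1 s[n-1]≡1 = begin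
  ι (totKA n) * (pow r k * s)
    ≡⟨ trans (cong (_* (pow r k * s)) (ι-sumFrom-a-reversed k f)) (*-comm _ (pow r k * s)) ⟩
  (pow r k * s) * sumℚ (suc k) g
    ≡⟨ sym (*-distribˡ-sumℚ (suc k) (pow r k * s) g) ⟩
  sumℚ (suc k) (λ j → pow r k * s * g j)
    ≡⟨ sumℚ-cong (suc k) (λ j j≤k → term j (ℕP.≤-pred j≤k)) ⟩
  subtreeSum r k (edgeWeight k s) ∎
  where
  open ≡-Reasoning
  n = suc (suc k)
  f : ℕ → ℕ
  f i = i ℕ.* a n i
  g : ℕ → ℚ
  g j = ι (f (suc (k ∸ j)))
  regroup : ∀ p s c A → p * s * (c * A) ≡ (c * s) * (A * p)
  regroup = solve-∀ ℚring
  term : ∀ j → j ℕ.≤ k → pow r k * s * g j ≡ edgeWeight k s j * subtreeTerm r k j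
  term j j≤k = begin
    pow r k * s * ι (suc (k ∸ j) ℕ.* a n (suc (k ∸ j)))
      ≡⟨ cong (pow r k * s *_) (ι-homo-* (suc (k ∸ j)) (a n (suc (k ∸ j)))) ⟩
    pow r k * s * (ι (suc (k ∸ j)) * ι (a n (suc (k ∸ j))))
      ≡⟨ regroup (pow r k) s (ι (suc (k ∸ j))) (ι (a n (suc (k ∸ j)))) ⟩
    (ι (suc (k ∸ j)) * s) * (ι (a n (suc (k ∸ j))) * pow r k)
      ≡⟨ cong₂ _*_ (subst (λ m → ι m * s ≡ 1ℚ - ι j * s) (ℕP.+-∸-assoc 1 j≤k) (ι[m∸i]*r≡1-ι[i]*r (ℕP.m≤n⇒m≤1+n j≤k) s[n-1]≡1))
                   (ι-a*rᵏ≡subtreeTerm k j rn≡1 j≤k) ⟩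
    (1ℚ - ι j * s) * subtreeTerm r k j
      ≡⟨ cong (λ z → (1ℚ - ι z * s) * subtreeTerm r k j) (sym (ℕP.m≤n⇒m⊓n≡m j≤k)) ⟩
    edgeWeight k s j * subtreeTerm r k j ∎

ι-a[n-1]*rᵏ≡1 : ∀ {r} k → r * ι (suc (suc k)) ≡ 1ℚ → ι (a (suc (suc k)) (suc k)) * pow r k ≡ 1ℚ
ι-a[n-1]*rᵏ≡1 {r} k rn≡1 = begin
  ι ((n C n) ℕ.* (n ℕ.^ k)) * pow r k    ≡⟨ cong (λ z → ι (z ℕ.* (n ℕ.^ k)) * pow r k) (nCn≡1 n) ⟩
  ι (1 ℕ.* (n ℕ.^ k)) * pow r k          ≡⟨ cong (λ z → ι z * pow r k) (ℕP.*-identityˡ (n ℕ.^ k)) ⟩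
  ι (n ℕ.^ k) * pow r k                  ≡⟨ cong (_* pow r k) (ι-homo-^ n k) ⟩
  pow (ι n) k * pow r k                  ≡⟨ sym (pow-distribʳ-* (ι n) r k) ⟩
  pow (ι n * r) k                        ≡⟨ cong (λ w → pow w k) (trans (*-comm (ι n) r) rn≡1) ⟩
  pow 1ℚ k                               ≡⟨ pow-1ℚ k ⟩
  1ℚ                                     ∎
  where
  open ≡-Reasoning
  n = suc (suc k)

admissible-1 : ∀ {r} → 0ℚ ≤ r → AdmissibleWeight (λ _ → 1ℚ) r
admissible-1 0≤r j = 0≤1 , ≤-refl , 0≤* (ι-nonNeg j) (0≤* (ι-nonNeg 2) 0≤r)

admissible-edgeWeight : ∀ {r s} k → 0ℚ ≤ r → 0ℚ ≤ s → r * ι (suc (suc k)) ≡ 1ℚ → s * ι (suc k) ≡ 1ℚ →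
  AdmissibleWeight (edgeWeight k s) r
admissible-edgeWeight {r} {s} k 0≤r 0≤s rn≡1 s[n-1]≡1 j =
  p≤q⇒0≤q-p capped≤1 , 0≤p⇒1-p≤1 0≤capped , bound
  where
  open ≤-Reasoning
  m = j ℕ.⊓ k
  capped≤1 : ι m * s ≤ 1ℚ
  capped≤1 = ι*r≤1 (ℕP.≤-trans (ℕP.m⊓n≤n j k) (ℕP.n≤1+n k)) 0≤s s[n-1]≡1
  0≤capped = 0≤* (ι-nonNeg m) 0≤s
  regroup : ∀ s r t c → s * (r * (t * c)) ≡ t * r * (s * c)
  regroup = solve-∀ ℚring
  n≤2[n-1] : suc (suc k) ℕ.≤ 2 ℕ.* suc k
  n≤2[n-1] = s≤s (ℕP.≤-trans (s≤s (ℕP.m≤m+n k (k ℕ.+ 0))) (ℕP.≤-reflexive (sym (ℕP.+-suc k (k ℕ.+ 0)))))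
  s≤2r : s ≤ ι 2 * r
  s≤2r = begin
    s                                  ≡⟨ sym (trans (cong (s *_) rn≡1) (*-identityʳ s)) ⟩
    s * (r * ι (suc (suc k)))          ≤⟨ *-monoˡ-≤-0≤ 0≤s (*-monoˡ-≤-0≤ 0≤r (ι-mono-≤ n≤2[n-1])) ⟩
    s * (r * ι (2 ℕ.* suc k))          ≡⟨ cong (λ w → s * (r * w)) (ι-homo-* 2 (suc k)) ⟩
    s * (r * (ι 2 * ι (suc k)))        ≡⟨ regroup s r (ι 2) (ι (suc k)) ⟩
    ι 2 * r * (s * ι (suc k))          ≡⟨ trans (cong (ι 2 * r *_) s[n-1]≡1) (*-identityʳ _) ⟩
    ι 2 * r                            ∎
  cancel : ∀ c → 1ℚ - (1ℚ - c) ≡ c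
  cancel = solve-∀ ℚring
  bound : ∣ 1ℚ - edgeWeight k s j ∣ ≤ ι j * (ι 2 * r)
  bound = begin
    ∣ 1ℚ - (1ℚ - ι m * s) ∣    ≡⟨ trans (cong ∣_∣ (cancel (ι m * s))) (0≤p⇒∣p∣≡p 0≤capped) ⟩
    ι m * s                    ≤⟨ *-mono-≤-0≤ (ι-nonNeg m) 0≤s (ι-mono-≤ (ℕP.m⊓n≤m j k)) s≤2r ⟩
    ι j * (ι 2 * r)            ∎

-- the j = 0 term (the spanning trees) is already 1
1≤subtreeSum : ∀ {r} k (w : ℕ → ℚ) → 0ℚ ≤ r → r * ι (suc (suc k)) ≡ 1ℚ → AdmissibleWeight w r → w 0 ≡ 1ℚ →
  1ℚ ≤ subtreeSum r k w
1≤subtreeSum {r} k w 0≤r rn≡1 admissible w0≡1 = begin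
  1ℚ                                                              ≡⟨ sym (+-identityʳ 1ℚ) ⟩
  1ℚ + 0ℚ                                                         ≤⟨ +-mono-≤ (≤-reflexive (sym first-term≡1)) (sumℚ-nonNeg k rest-nonNeg) ⟩
  w 0 * subtreeTerm r k 0 + sumℚ k (λ i → w (suc i) * subtreeTerm r k (suc i))
                                                                  ≡⟨ sym (sumℚ-shift k (λ j → w j * subtreeTerm r k j)) ⟩
  subtreeSum r k w                                                ∎
  where
  open ≤-Reasoning
  rest-nonNeg : ∀ i → i ℕ.< k → 0ℚ ≤ w (suc i) * subtreeTerm r k (suc i)
  rest-nonNeg i i<k = 0≤* (proj₁ (admissible (suc i))) (proj₁ (subtreeTerm-bounds k (suc i) 0≤r rn≡1 i<k))
  drop : ∀ r → 1ℚ - 0ℚ * r ≡ 1ℚ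
  drop = solve-∀ ℚring
  units : ∀ p → 1ℚ * (1ℚ * 1ℚ * p) ≡ p
  units = solve-∀ ℚring
  first-term≡1 : w 0 * subtreeTerm r k 0 ≡ 1ℚ
  first-term≡1 = trans (cong₂ _*_ w0≡1 (cong (λ z → 1ℚ * 1ℚ * pow z k) (drop r))) (trans (units (pow 1ℚ k)) (pow-1ℚ k))

frac-*≡1 : ∀ x d c → ι x * c ≡ 1ℚ → 1ℚ ≤ ι d * c → frac x d * (ι d * c) ≡ 1ℚ
frac-*≡1 x zero    c _ 1≤0*c = ⊥-elim (<-irrefl refl (<-≤-trans 0<1 (subst (1ℚ ≤_) (*-zeroˡ c) 1≤0*c)))
frac-*≡1 x (suc d) c xc≡1 _  =
  trans (sym (*-assoc (frac x (suc d)) (ι (suc d)) c)) (trans (cong (_* c) (frac-*-denominator x d)) xc≡1)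

∣P-L∣≤ : ∀ {P S L F C ε η} → P * S ≡ 1ℚ → 1ℚ ≤ S → ∣ L ∣ ≤ C → ∣ 1ℚ - L * F ∣ ≤ ε → ∣ F - S ∣ ≤ η →
  ∣ P - L ∣ ≤ ε + C * η
∣P-L∣≤ {P} {S} {L} {F} {C} {ε} {η} PS≡1 1≤S ∣L∣≤C 1-LF≤ε F-S≤η = begin
  ∣ P - L ∣                               ≡⟨ cong (λ w → ∣ P - w ∣) (sym (trans (cong (L *_) PS≡1) (*-identityʳ L))) ⟩
  ∣ P - L * (P * S) ∣                     ≡⟨ cong ∣_∣ (factor P L S F) ⟩
  ∣ P * ((1ℚ - L * F) + L * (F - S)) ∣    ≤⟨ ∣*∣-mono-≤ ∣P∣≤1 (∣p+q∣≤∣p∣+∣q∣ (1ℚ - L * F) (L * (F - S))) ⟩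
  1ℚ * (∣ 1ℚ - L * F ∣ + ∣ L * (F - S) ∣) ≤⟨ ≤-trans (≤-reflexive (*-identityˡ _)) (+-mono-≤ 1-LF≤ε (∣*∣-mono-≤ ∣L∣≤C F-S≤η)) ⟩
  ε + C * η                               ∎
  where
  open ≤-Reasoning
  factor : ∀ P L S F → P - L * (P * S) ≡ P * ((1ℚ - L * F) + L * (F - S))
  factor = solve-∀ ℚring
  ∣P∣≤1 : ∣ P ∣ ≤ 1ℚ
  ∣P∣≤1 = begin
    ∣ P ∣             ≡⟨ sym (*-identityʳ _) ⟩
    ∣ P ∣ * 1ℚ        ≤⟨ *-monoˡ-≤-0≤ (0≤∣p∣ P) 1≤S ⟩
    ∣ P ∣ * S         ≡⟨ cong (∣ P ∣ *_) (sym (0≤p⇒∣p∣≡p (≤-trans 0≤1 1≤S))) ⟩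
    ∣ P ∣ * ∣ S ∣     ≡⟨ sym (∣p*q∣≡∣p∣*∣q∣ P S) ⟩
    ∣ P * S ∣         ≡⟨ cong ∣_∣ PS≡1 ⟩
    1ℚ                ∎

reciprocal→LTrunc : ∀ (P S : ℕ → ℚ) → (∀ k → P (suc (suc k)) * S k ≡ 1ℚ) → (∀ k → 1ℚ ≤ S k) →
  (∀ δ → 0ℚ < δ → Eventually (λ k → Eventually (λ M → ∣ S k - expSum M (xTrunc M) ∣ ≤ δ))) →
  ConvergesTo P LTrunc
reciprocal→LTrunc P S PS≡1 1≤S S→expSum ε 0<ε =
  eventually-suc-suc⁻ (eventually-map close (S→expSum (δ₂ * 1/suc 20) (0<* 0<δ₂ (0<1/suc 20))))
  where
  δ = ε * 1/suc 1
  0<δ = 0<* 0<ε (0<1/suc 1)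
  δ₂ = δ * 1/suc 1
  0<δ₂ = 0<* 0<δ (0<1/suc 1)
  δ<ε : δ < ε
  δ<ε = begin-strict
    δ          ≡⟨ sym (+-identityʳ δ) ⟩
    δ + 0ℚ     <⟨ +-monoʳ-< δ 0<δ ⟩
    δ + δ      ≡⟨ half+half ε ⟩
    ε          ∎
    where open ≤-Reasoning
  close : ∀ k → Eventually (λ M → ∣ S k - expSum M (xTrunc M) ∣ ≤ δ₂ * 1/suc 20) →
    Eventually (λ M → ∣ P (suc (suc k)) - LTrunc M ∣ < ε)
  close k S≈ = eventually-map bound (eventually-× (expSum-neg*expSum→1 δ₂ 0<δ₂) S≈)
    where
    bound : ∀ M → (∀ y → ∣ y ∣ ≤ ι 3 → ∣ 1ℚ - expSum M (- y) * expSum M y ∣ ≤ δ₂) ×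
      ∣ S k - expSum M (xTrunc M) ∣ ≤ δ₂ * 1/suc 20 → ∣ P (suc (suc k)) - LTrunc M ∣ < ε
    bound M (inverse , S-F≤) = ≤-<-trans
      (≤-trans (∣P-L∣≤ {P (suc (suc k))} (PS≡1 k) (1≤S k) (∣expSum∣≤21 M ∣-x∣≤3) (inverse x (∣xTrunc∣≤3 M))
                  (subst (_≤ δ₂ * 1/suc 20) (∣p-q∣≡∣q-p∣ (S k) (expSum M x)) S-F≤))
               (≤-reflexive (trans (cong (δ₂ +_) (*-1/suc δ₂ 20)) (half+half δ))))
      δ<ε
      where
      x = xTrunc M
      ∣-x∣≤3 = subst (_≤ ι 3) (sym (∣-p∣≡∣p∣ x)) (∣xTrunc∣≤3 M)

weighted→LTrunc : ∀ (P : ℕ → ℚ) (w : ℕ → ℕ → ℚ) →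
  (∀ k → AdmissibleWeight (w k) (1/suc (suc k))) → (∀ k → w k 0 ≡ 1ℚ) →
  (∀ k → P (suc (suc k)) * subtreeSum (1/suc (suc k)) k (w k) ≡ 1ℚ) →
  ConvergesTo P LTrunc
weighted→LTrunc P w admissible w0≡1 P*S≡1 = reciprocal→LTrunc P S P*S≡1
  (λ k → 1≤subtreeSum k (w k) (0≤1/suc (suc k)) (1/suc-inverse (suc k)) (admissible k) (w0≡1 k))
  (λ δ 0<δ → eventually-map (λ k S≈ → S≈ (1/suc (suc k)) (0≤1/suc (suc k)) (1/suc-inverse (suc k)) (w k) (admissible k))
                            (subtreeSum→expSum δ 0<δ))
  where
  S : ℕ → ℚ
  S k = subtreeSum (1/suc (suc k)) k (w k)

p*subtreeSum≡1 : ∀ k → p (suc (suc k)) * subtreeSum (1/suc (suc k)) k (λ _ → 1ℚ) ≡ 1ℚ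
p*subtreeSum≡1 k = subst (λ z → p (suc (suc k)) * z ≡ 1ℚ) totA≡S
  (frac-*≡1 (a (suc (suc k)) (suc k)) (totA (suc (suc k))) (pow r k) (ι-a[n-1]*rᵏ≡1 k rn≡1)
    (subst (1ℚ ≤_) (sym totA≡S) (1≤subtreeSum k (λ _ → 1ℚ) (0≤1/suc (suc k)) rn≡1 (admissible-1 (0≤1/suc (suc k))) refl)))
  where
  r = 1/suc (suc k)
  rn≡1 = 1/suc-inverse (suc k)
  totA≡S : ι (totA (suc (suc k))) * pow r k ≡ subtreeSum r k (λ _ → 1ℚ)
  totA≡S = ι-totA*rᵏ≡subtreeSum k rn≡1

q*subtreeSum≡1 : ∀ k → q (suc (suc k)) * subtreeSum (1/suc (suc k)) k (edgeWeight k (1/suc k)) ≡ 1ℚ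
q*subtreeSum≡1 k = subst (λ z → q (suc (suc k)) * z ≡ 1ℚ) totKA≡S
  (frac-*≡1 (suc k ℕ.* a (suc (suc k)) (suc k)) (totKA (suc (suc k))) (pow r k * s) numerator≡1
    (subst (1ℚ ≤_) (sym totKA≡S) (1≤subtreeSum k (edgeWeight k s) (0≤1/suc (suc k)) rn≡1 admissible (edgeWeight-0 k s))))
  where
  open ≡-Reasoning
  r = 1/suc (suc k)
  s = 1/suc k
  rn≡1 = 1/suc-inverse (suc k)
  totKA≡S : ι (totKA (suc (suc k))) * (pow r k * s) ≡ subtreeSum r k (edgeWeight k s)
  totKA≡S = ι-totKA*rᵏs≡subtreeSum k rn≡1 (1/suc-inverse k)
  admissible : AdmissibleWeight (edgeWeight k s) r
  admissible = admissible-edgeWeight k (0≤1/suc (suc k)) (0≤1/suc k) rn≡1 (1/suc-inverse k)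
  regroup : ∀ c A p s → c * A * (p * s) ≡ (s * c) * (A * p)
  regroup = solve-∀ ℚring
  numerator≡1 : ι (suc k ℕ.* a (suc (suc k)) (suc k)) * (pow r k * s) ≡ 1ℚ
  numerator≡1 = begin
    ι (suc k ℕ.* a (suc (suc k)) (suc k)) * (pow r k * s)
      ≡⟨ cong (_* (pow r k * s)) (ι-homo-* (suc k) (a (suc (suc k)) (suc k))) ⟩
    ι (suc k) * ι (a (suc (suc k)) (suc k)) * (pow r k * s)
      ≡⟨ regroup (ι (suc k)) (ι (a (suc (suc k)) (suc k))) (pow r k) s ⟩
    (s * ι (suc k)) * (ι (a (suc (suc k)) (suc k)) * pow r k)
      ≡⟨ cong₂ _*_ (1/suc-inverse k) (ι-a[n-1]*rᵏ≡1 k rn≡1) ⟩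
    1ℚ * 1ℚ
      ≡⟨ *-identityˡ 1ℚ ⟩
    1ℚ ∎

theorem1p1 : ConvergesTo p LTrunc × ConvergesTo q LTrunc
theorem1p1 =
  weighted→LTrunc p (λ _ _ → 1ℚ) (λ k → admissible-1 (0≤1/suc (suc k))) (λ _ → refl) p*subtreeSum≡1 ,
  weighted→LTrunc q (λ k → edgeWeight k (1/suc k))
    (λ k → admissible-edgeWeight k (0≤1/suc (suc k)) (0≤1/suc k) (1/suc-inverse (suc k)) (1/suc-inverse k))
    (λ k → edgeWeight-0 k (1/suc k)) q*subtreeSum≡1
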